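{- Let $n$ be a positive integer, $d\neq1$ a positive divisor of $n$, and $q\in(0,1)$. Let $c_0,\dots,c_{n-1}$ be independent with $\mathbb{P}[c_j=1]=q$, $\mathbb{P}[c_j=0]=1-q$, let $f(x)=\sum_{j=0}^{n-1}c_jx^j$, and let $P_q(d,n)$ be the probability that $\Phi_d(x)$ divides $f(x)$ modulo $x^n-1$ (equivalently, $f(\zeta)=0$ for a primitive complex $d$-th root of unity $\zeta$). Let $M(q,N)=\max_{0\le k\le N}\binom{N}{k}q^k(1-q)^{N-k}$. Then $P_q(d,n)\le M(q,n/d)^{\varphi(d)}$, where $\varphi$ is Euler's totient function. If moreover $d$ is prime, then $P_q(d,n)\ge M(q,n/d)^d$.
   Context: $\Phi_d(x)$ denotes the $d$-th cyclotomic polynomial, the minimal polynomial over $\mathbb{Q}$ of a primitive complex $d$-th root of unity. "$f\equiv0\pmod{\Phi_d}$" is considered in $\mathbb{Z}[x]/(x^n-1)$; since $\Phi_d\mid x^n-1$ this is the same as $\Phi_d\mid f$ in $\mathbb{Z}[x]$.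
   Formalization: The probability q takes only rational values in (0,1). -}

module Defs where

open import Data.Bool using (Bool; true; false; if_then_else_)
open import Data.Nat as ℕ using (ℕ; zero; suc; _≤ᵇ_)
open import Data.Nat.Divisibility using (_∣?_)
open import Data.Nat.GCD using (gcd)
open import Data.Nat.Combinatorics using (_C_)
open import Data.Integer as ℤ using (ℤ; +_)
open import Data.Rational as ℚ using (ℚ; 0ℚ; 1ℚ)
open import Data.List using (List; []; _∷_; _++_; map; filter; reverse; length; foldr; upTo; applyUpTo; concatMap; replicate)
open import Data.Vec using (Vec; []; _∷_; toList)
open import Data.Product using (_×_; _,_; proj₁; proj₂; ∃)
open import Relation.Nullary using (Dec; does)
open import Relation.Unary using (Pred)
open import Level using (0ℓ)
open import Relation.Binary.PropositionalEquality using (_≡_)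

-- Integer polynomials as coefficient lists, lowest degree first.

Poly : Set
Poly = List ℤ

coeff : Poly → ℕ → ℤ
coeff []       _       = + 0
coeff (a ∷ _)  zero    = a
coeff (_ ∷ as) (suc i) = coeff as i

addP : Poly → Poly → Poly
addP []       q        = q
addP p        []       = p
addP (a ∷ as) (b ∷ bs) = (a ℤ.+ b) ∷ addP as bs

scaleP : ℤ → Poly → Poly
scaleP c = map (c ℤ.*_)

mulP : Poly → Poly → Poly
mulP []       q = []
mulP (a ∷ as) q = addP (scaleP a q) (+ 0 ∷ mulP as q)

prodP : List Poly → Poly
prodP = foldr mulP (+ 1 ∷ [])

_∣ₚ_ : Poly → Poly → Set
g ∣ₚ f = ∃ λ (h : Poly) → ∀ i → coeff (mulP g h) i ≡ coeff f i

-- Exact division by a monic polynomial (long division), used only to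
-- compute the cyclotomic polynomials via  x^d - 1 = ∏_{e ∣ d} Φ_e.

private
  subL : ℤ → List ℤ → List ℤ → List ℤ
  subL a []       as       = as
  subL a (b ∷ bs) []       = []
  subL a (b ∷ bs) (x ∷ xs) = (x ℤ.- a ℤ.* b) ∷ subL a bs xs

  -- high-degree-first long division; bs = divisor without its leading 1
  divH : ℕ → List ℤ → List ℤ → List ℤ
  divH zero    bs _        = []
  divH (suc k) bs []       = []
  divH (suc k) bs (a ∷ as) =
    if length bs ≤ᵇ length as then a ∷ divH k bs (subL a bs as) else []

  tailL : List ℤ → List ℤ
  tailL []       = []
  tailL (_ ∷ xs) = xs

-- quotient of f by the monic polynomial g (g without trailing zeros)
quotMonic : Poly → Poly → Poly
quotMonic f g = reverse (divH (length f) (tailL (reverse g)) (reverse f))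

xpm1 : ℕ → Poly
xpm1 zero    = []
xpm1 (suc k) = ℤ.- (+ 1) ∷ replicate k (+ 0) ++ (+ 1 ∷ [])

newCyc : ℕ → List (ℕ × Poly) → Poly
newCyc e T = quotMonic (xpm1 e) (prodP (map proj₂ (filter (λ p → proj₁ p ∣? e) T)))

cycloTable : ℕ → List (ℕ × Poly)
cycloTable zero    = []
cycloTable (suc n) = cycloTable n ++ ((suc n , newCyc (suc n) (cycloTable n)) ∷ [])

-- d-th cyclotomic polynomial Φ_d (d ≥ 1; Φ 0 is a junk value)
Φ : ℕ → Poly
Φ zero    = + 1 ∷ []
Φ (suc n) = newCyc (suc n) (cycloTable n)

totient : ℕ → ℕ
totient d = length (filter (λ k → gcd k d ℕ.≟ 1) (applyUpTo suc d))

allVecs : (n : ℕ) → List (Vec Bool n)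
allVecs zero    = [] ∷ []
allVecs (suc n) = concatMap (λ v → (true ∷ v) ∷ (false ∷ v) ∷ []) (allVecs n)

polyOf : ∀ {n} → Vec Bool n → Poly
polyOf c = map (λ b → if b then + 1 else + 0) (toList c)

_^ᵠ_ : ℚ → ℕ → ℚ
q ^ᵠ zero  = 1ℚ
q ^ᵠ suc k = q ℚ.* (q ^ᵠ k)

weight : ℚ → ∀ {n} → Vec Bool n → ℚ
weight q []      = 1ℚ
weight q (b ∷ c) = (if b then q else 1ℚ ℚ.- q) ℚ.* weight q c

sumℚ : List ℚ → ℚ
sumℚ = foldr ℚ._+_ 0ℚ

Prob : ℚ → (n : ℕ) → {E : Pred (Vec Bool n) 0ℓ} → (∀ c → Dec (E c)) → ℚ
Prob q n dec = sumℚ (map (λ c → if does (dec c) then weight q c else 0ℚ) (allVecs n))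

Pq : ℚ → (d n : ℕ) → (∀ (c : Vec Bool n) → Dec (Φ d ∣ₚ polyOf c)) → ℚ
Pq q d n dec = Prob q n dec

ℕtoℚ : ℕ → ℚ
ℕtoℚ k = (+ k) ℚ./ 1

-- M(q,N) = max_{0 ≤ k ≤ N} C(N,k) q^k (1-q)^(N-k)   (all terms are ≥ 0)
M : ℚ → ℕ → ℚ
M q N = foldr ℚ._⊔_ 0ℚ
  (map (λ k → ℕtoℚ (N C k) ℚ.* (q ^ᵠ k) ℚ.* ((1ℚ ℚ.- q) ^ᵠ (N ℕ.∸ k))) (upTo (suc N)))

{-# OPTIONS --safe #-}
-- Write n = N d and read the coefficients of f row by row as an N × d matrix of independent
-- Bernoulli(q) entries. Modulo x^d - 1, which Φ d divides, f is congruent to the column-sum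
-- polynomial g = s₀ + s₁ x + ⋯ + s_{d-1} x^(d-1), whose coefficients are independent Binomial(N, q)
-- variables. As Φ d is monic of degree φ(d), a multiple of Φ d of degree < d is determined by its
-- coefficients in degrees ≥ φ(d): once the last d - φ(d) column sums are fixed, Φ d ∣ f pins down
-- the first φ(d), and each of these takes any given value with probability at most M(q, N).
-- For prime d, Φ d = 1 + x + ⋯ + x^(d-1) divides g whenever all column sums equal a common k,
-- which has probability (C(N,k) q^k (1-q)^(N-k))^d.
--
-- The Φ of Defs is computed by exact long division. That it is monic with x^d - 1 = ∏_{e ∣ d} Φ e
-- follows by strong induction on d, because distinct Φ e and Φ e′ are coprime over ℚ: a combination
-- of x^e - 1 and x^e′ - 1 equals x^gcd(e,e′) - 1. Gauss' identity ∑_{e ∣ d} φ(e) = d then gives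
-- deg Φ d = φ(d).
module Submission where

open import Defs
open import Data.Nat using (ℕ; _<_)
open import Data.Nat.Divisibility using (_∣_; quotient)
open import Data.Nat.Primality using (Prime)
open import Data.Rational as ℚ using (ℚ; 0ℚ; 1ℚ)
open import Data.Vec using (Vec)
open import Data.Bool using (Bool)
open import Data.Product using (_×_)
open import Relation.Nullary using (Dec)
open import Relation.Binary.PropositionalEquality using (_≢_)
import Data.Nat as ℕ
import Data.Rational.Properties as ℚP
open import Data.Nat.Divisibility using (divides)
open import Relation.Binary.PropositionalEquality using (refl; subst)
open import Data.Product using (_,_)

module Polynomial where

  open import Defs
  open import Data.Nat using (zero; suc)
  open import Data.Integer as ℤ using (ℤ; +_; _+_; _*_; -_; _-_)
  import Data.Integer.Properties as ℤP
  open import Data.Integer.Solver using (module +-*-Solver)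
  open +-*-Solver using (solve; _:+_; _:*_; _:=_)
  open import Data.List using ([]; _∷_; map; drop)
  open import Relation.Binary.PropositionalEquality
  import Relation.Binary.Reasoning.Setoid as SetoidReasoning
  open import Algebra.Bundles using (CommutativeRing)
  open import Algebra.Solver.Ring.AlmostCommutativeRing
  import Algebra.Solver.Ring as RingSolver
  open import Data.Product using (_,_)
  open import Data.Maybe using (Maybe; just; nothing)
  open import Relation.Nullary using (yes; no)

  infix 4 _≋_ _≈_
  _≋_ : Poly → Poly → Set
  p ≋ q = ∀ i → coeff p i ≡ coeff q i

  -- A record rather than _≋_ itself, so that p and q can be inferred from p ≈ q.
  record _≈_ (p q : Poly) : Set where
    constructor mk≈
    field
      at : p ≋ q
  open _≈_ public

  ≈-refl : ∀ {p} → p ≈ p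
  ≈-refl = mk≈ (λ i → refl)

  ≈-sym : ∀ {p q} → p ≈ q → q ≈ p
  ≈-sym e = mk≈ (λ i → sym (at e i))

  ≈-trans : ∀ {p q r} → p ≈ q → q ≈ r → p ≈ r
  ≈-trans e f = mk≈ (λ i → trans (at e i) (at f i))

  negP : Poly → Poly
  negP = map (λ x → - x)

  shift : Poly → Poly
  shift p = + 0 ∷ p

  subP : Poly → Poly → Poly
  subP p q = addP p (negP q)

  oneP : Poly
  oneP = + 1 ∷ []

  coeff-add : ∀ p q i → coeff (addP p q) i ≡ coeff p i + coeff q i
  coeff-add [] q i = sym (ℤP.+-identityˡ _)
  coeff-add (a ∷ as) [] zero = sym (ℤP.+-identityʳ a)
  coeff-add (a ∷ as) [] (suc i) = sym (ℤP.+-identityʳ _)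
  coeff-add (a ∷ as) (b ∷ bs) zero = refl
  coeff-add (a ∷ as) (b ∷ bs) (suc i) = coeff-add as bs i

  coeff-scale : ∀ c p i → coeff (scaleP c p) i ≡ c * coeff p i
  coeff-scale c [] i = sym (ℤP.*-zeroʳ c)
  coeff-scale c (a ∷ as) zero = refl
  coeff-scale c (a ∷ as) (suc i) = coeff-scale c as i

  coeff-neg : ∀ p i → coeff (negP p) i ≡ - coeff p i
  coeff-neg [] i = refl
  coeff-neg (a ∷ as) zero = refl
  coeff-neg (a ∷ as) (suc i) = coeff-neg as i

  coeff-sub : ∀ p q i → coeff (subP p q) i ≡ coeff p i - coeff q i
  coeff-sub p q i = trans (coeff-add p (negP q) i) (cong (λ z → coeff p i + z) (coeff-neg q i))

  add-cong : ∀ {p p′ q q′} → p ≈ p′ → q ≈ q′ → addP p q ≈ addP p′ q′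
  add-cong {p} {p′} {q} {q′} e f = mk≈ λ i →
    trans (coeff-add p q i) (trans (cong₂ _+_ (at e i) (at f i)) (sym (coeff-add p′ q′ i)))

  scale-cong : ∀ {c c′ p p′} → c ≡ c′ → p ≈ p′ → scaleP c p ≈ scaleP c′ p′
  scale-cong {c} {c′} {p} {p′} e f = mk≈ λ i →
    trans (coeff-scale c p i) (trans (cong₂ _*_ e (at f i)) (sym (coeff-scale c′ p′ i)))

  neg-cong : ∀ {p p′} → p ≈ p′ → negP p ≈ negP p′
  neg-cong {p} {p′} e = mk≈ λ i → trans (coeff-neg p i) (trans (cong (λ x → - x) (at e i)) (sym (coeff-neg p′ i)))

  shift-cong : ∀ {p p′} → p ≈ p′ → shift p ≈ shift p′
  shift-cong {p} {p′} e = mk≈ h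
    where
    h : shift p ≋ shift p′
    h zero = refl
    h (suc i) = at e i

  sub-cong : ∀ {p p′ q q′} → p ≈ p′ → q ≈ q′ → subP p q ≈ subP p′ q′
  sub-cong e f = add-cong e (neg-cong f)

  coeff-mul-cons : ∀ a as q i → coeff (mulP (a ∷ as) q) i ≡ a * coeff q i + coeff (shift (mulP as q)) i
  coeff-mul-cons a as q i = trans (coeff-add (scaleP a q) (shift (mulP as q)) i) (cong (λ z → z + coeff (shift (mulP as q)) i) (coeff-scale a q i))

  mul-congʳ : ∀ p {q q′} → q ≈ q′ → mulP p q ≈ mulP p q′
  mul-congʳ [] e = ≈-refl
  mul-congʳ (a ∷ as) e = add-cong (scale-cong {a} {a} refl e) (shift-cong (mul-congʳ as e))

  tail≈ : ∀ {a as p} → (a ∷ as) ≈ p → as ≈ drop 1 p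
  tail≈ {p = []} e = mk≈ λ j → at e (suc j)
  tail≈ {p = b ∷ bs} e = mk≈ λ j → at e (suc j)

  mul-zeroˡ : ∀ {p} q → p ≈ [] → mulP p q ≈ []
  mul-zeroˡ {[]} q e = ≈-refl
  mul-zeroˡ {a ∷ as} q e = mk≈ λ i →
    trans (coeff-mul-cons a as q i)
      (trans (cong₂ (λ x y → x * coeff q i + y) (at e zero) (at (shift-cong (mul-zeroˡ q (tail≈ e))) i))
        (h i))
    where
    h : ∀ i → + 0 * coeff q i + coeff (shift []) i ≡ + 0
    h zero = refl
    h (suc i) = refl

  mul-congˡ : ∀ {p p′} q → p ≈ p′ → mulP p q ≈ mulP p′ q
  mul-congˡ {[]} {[]} q e = ≈-refl
  mul-congˡ {[]} {a ∷ as} q e = ≈-sym (mul-zeroˡ q (≈-sym e))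
  mul-congˡ {a ∷ as} {[]} q e = mul-zeroˡ q e
  mul-congˡ {a ∷ as} {b ∷ bs} q e =
    add-cong (scale-cong {a} {b} {q} {q} (at e zero) ≈-refl) (shift-cong (mul-congˡ q (tail≈ e)))

  mul-cong : ∀ {p p′ q q′} → p ≈ p′ → q ≈ q′ → mulP p q ≈ mulP p′ q′
  mul-cong {p} {p′} {q} {q′} e f = ≈-trans (mul-congˡ q e) (mul-congʳ p′ f)

  mul-zeroʳ : ∀ p → mulP p [] ≈ []
  mul-zeroʳ p = mk≈ (h p)
    where
    h : ∀ p → mulP p [] ≋ []
    h [] i = refl
    h (a ∷ as) zero = refl
    h (a ∷ as) (suc i) = h as i

  mul-consʳ : ∀ p b bs → mulP p (b ∷ bs) ≈ addP (scaleP b p) (shift (mulP p bs))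
  mul-consʳ p b bs = mk≈ (h p)
    where
    h : ∀ p → mulP p (b ∷ bs) ≋ addP (scaleP b p) (shift (mulP p bs))
    h [] zero = refl
    h [] (suc i) = refl
    h (a ∷ as) zero = cong (λ z → z + + 0) (ℤP.*-comm a b)
    h (a ∷ as) (suc i) =
      begin
        coeff (addP (scaleP a bs) (mulP as (b ∷ bs))) i
      ≡⟨ coeff-add (scaleP a bs) (mulP as (b ∷ bs)) i ⟩
        coeff (scaleP a bs) i + coeff (mulP as (b ∷ bs)) i
      ≡⟨ cong (λ z → coeff (scaleP a bs) i + z) (trans (h as i) (coeff-add (scaleP b as) (shift (mulP as bs)) i)) ⟩
        coeff (scaleP a bs) i + (coeff (scaleP b as) i + coeff (shift (mulP as bs)) i)
      ≡⟨ solve 3 (λ x y z → x :+ (y :+ z) := y :+ (x :+ z)) refl (coeff (scaleP a bs) i) (coeff (scaleP b as) i) (coeff (shift (mulP as bs)) i) ⟩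
        coeff (scaleP b as) i + (coeff (scaleP a bs) i + coeff (shift (mulP as bs)) i)
      ≡⟨ cong (λ z → coeff (scaleP b as) i + z) (sym (coeff-add (scaleP a bs) (shift (mulP as bs)) i)) ⟩
        coeff (scaleP b as) i + coeff (addP (scaleP a bs) (shift (mulP as bs))) i
      ≡⟨ sym (coeff-add (scaleP b as) (addP (scaleP a bs) (shift (mulP as bs))) i) ⟩
        coeff (addP (scaleP b as) (addP (scaleP a bs) (shift (mulP as bs)))) i
      ∎
      where open ≡-Reasoning

  mul-comm : ∀ p q → mulP p q ≈ mulP q p
  mul-comm [] q = ≈-sym (mul-zeroʳ q)
  mul-comm (a ∷ as) q = ≈-trans (add-cong {scaleP a q} ≈-refl (shift-cong (mul-comm as q))) (≈-sym (mul-consʳ q a as))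

  coeff-shift-add : ∀ p q i → coeff (shift (addP p q)) i ≡ coeff (shift p) i + coeff (shift q) i
  coeff-shift-add p q zero = refl
  coeff-shift-add p q (suc i) = coeff-add p q i

  coeff-shift-scale : ∀ c p i → coeff (shift (scaleP c p)) i ≡ c * coeff (shift p) i
  coeff-shift-scale c p zero = sym (ℤP.*-zeroʳ c)
  coeff-shift-scale c p (suc i) = coeff-scale c p i

  add-identityʳ : ∀ p → addP p [] ≈ p
  add-identityʳ p = mk≈ λ i → trans (coeff-add p [] i) (ℤP.+-identityʳ _)

  mul-distribʳ : ∀ p p′ q → mulP (addP p p′) q ≈ addP (mulP p q) (mulP p′ q)
  mul-distribʳ [] p′ q = ≈-refl
  mul-distribʳ (a ∷ as) [] q = ≈-sym (add-identityʳ _)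
  mul-distribʳ (a ∷ as) (b ∷ bs) q = mk≈ λ i →
    let Q = coeff q i in
    begin
      coeff (mulP ((a + b) ∷ addP as bs) q) i
    ≡⟨ coeff-mul-cons (a + b) (addP as bs) q i ⟩
      (a + b) * Q + coeff (shift (mulP (addP as bs) q)) i
    ≡⟨ cong (λ z → (a + b) * Q + z) (trans (at (shift-cong (mul-distribʳ as bs q)) i) (coeff-shift-add (mulP as q) (mulP bs q) i)) ⟩
      (a + b) * Q + (coeff (shift (mulP as q)) i + coeff (shift (mulP bs q)) i)
    ≡⟨ solve 5 (λ a b Q x y → (a :+ b) :* Q :+ (x :+ y) := (a :* Q :+ x) :+ (b :* Q :+ y)) refl a b Q (coeff (shift (mulP as q)) i) (coeff (shift (mulP bs q)) i) ⟩
      (a * Q + coeff (shift (mulP as q)) i) + (b * Q + coeff (shift (mulP bs q)) i)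
    ≡⟨ sym (cong₂ _+_ (coeff-mul-cons a as q i) (coeff-mul-cons b bs q i)) ⟩
      coeff (mulP (a ∷ as) q) i + coeff (mulP (b ∷ bs) q) i
    ≡⟨ sym (coeff-add (mulP (a ∷ as) q) (mulP (b ∷ bs) q) i) ⟩
      coeff (addP (mulP (a ∷ as) q) (mulP (b ∷ bs) q)) i
    ∎
    where
    open ≡-Reasoning

  mul-scaleˡ : ∀ c q r → mulP (scaleP c q) r ≈ scaleP c (mulP q r)
  mul-scaleˡ c [] r = ≈-refl
  mul-scaleˡ c (b ∷ bs) r = mk≈ λ i →
    let R = coeff r i in
    begin
      coeff (mulP ((c * b) ∷ scaleP c bs) r) i
    ≡⟨ coeff-mul-cons (c * b) (scaleP c bs) r i ⟩
      (c * b) * R + coeff (shift (mulP (scaleP c bs) r)) i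
    ≡⟨ cong (λ z → (c * b) * R + z) (trans (at (shift-cong (mul-scaleˡ c bs r)) i) (coeff-shift-scale c _ i)) ⟩
      (c * b) * R + c * coeff (shift (mulP bs r)) i
    ≡⟨ solve 4 (λ c b R x → (c :* b) :* R :+ c :* x := c :* (b :* R :+ x)) refl c b R (coeff (shift (mulP bs r)) i) ⟩
      c * (b * R + coeff (shift (mulP bs r)) i)
    ≡⟨ cong (λ z → c * z) (sym (coeff-mul-cons b bs r i)) ⟩
      c * coeff (mulP (b ∷ bs) r) i
    ≡⟨ sym (coeff-scale c (mulP (b ∷ bs) r) i) ⟩
      coeff (scaleP c (mulP (b ∷ bs) r)) i
    ∎
    where
    open ≡-Reasoning

  mul-shiftˡ : ∀ s r → mulP (shift s) r ≈ shift (mulP s r)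
  mul-shiftˡ s r = mk≈ λ i → trans (coeff-mul-cons (+ 0) s r i) (trans (cong (λ z → z + coeff (shift (mulP s r)) i) (ℤP.*-zeroˡ (coeff r i))) (ℤP.+-identityˡ _))

  mul-assoc : ∀ p q r → mulP (mulP p q) r ≈ mulP p (mulP q r)
  mul-assoc [] q r = ≈-refl
  mul-assoc (a ∷ as) q r =
    ≈-trans (mul-distribʳ (scaleP a q) (shift (mulP as q)) r)
      (add-cong (mul-scaleˡ a q r)
        (≈-trans (mul-shiftˡ (mulP as q) r) (shift-cong (mul-assoc as q r))))

  coeff-shift[] : ∀ i → coeff (shift []) i ≡ + 0
  coeff-shift[] zero = refl
  coeff-shift[] (suc i) = refl

  mul-identityˡ : ∀ p → mulP oneP p ≈ p
  mul-identityˡ p = mk≈ λ i → trans (coeff-mul-cons (+ 1) [] p i) (trans (cong₂ _+_ (ℤP.*-identityˡ (coeff p i)) (coeff-shift[] i)) (ℤP.+-identityʳ _))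

  add-assoc : ∀ p q r → addP (addP p q) r ≈ addP p (addP q r)
  add-assoc p q r = mk≈ λ i → trans (coeff-add (addP p q) r i) (trans (cong (λ z → z + coeff r i) (coeff-add p q i))
    (trans (ℤP.+-assoc (coeff p i) (coeff q i) (coeff r i)) (sym (trans (coeff-add p (addP q r) i) (cong (λ z → coeff p i + z) (coeff-add q r i))))))

  add-comm : ∀ p q → addP p q ≈ addP q p
  add-comm p q = mk≈ λ i → trans (coeff-add p q i) (trans (ℤP.+-comm (coeff p i) (coeff q i)) (sym (coeff-add q p i)))

  add-identityˡ : ∀ p → addP [] p ≈ p
  add-identityˡ p = ≈-refl

  neg-inverseˡ : ∀ p → addP (negP p) p ≈ []
  neg-inverseˡ p = mk≈ λ i → trans (coeff-add (negP p) p i) (trans (cong (λ z → z + coeff p i) (coeff-neg p i)) (ℤP.+-inverseˡ (coeff p i)))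

  neg-inverseʳ : ∀ p → addP p (negP p) ≈ []
  neg-inverseʳ p = ≈-trans (add-comm p (negP p)) (neg-inverseˡ p)

  commutativeRing : CommutativeRing _ _
  commutativeRing = record
    { Carrier = Poly
    ; _≈_ = _≈_
    ; _+_ = addP
    ; _*_ = mulP
    ; -_ = negP
    ; 0# = []
    ; 1# = oneP
    ; isCommutativeRing = record
      { isRing = record
        { +-isAbelianGroup = record
          { isGroup = record
            { isMonoid = record
              { isSemigroup = record
                { isMagma = record
                  { isEquivalence = record { refl = ≈-refl ; sym = ≈-sym ; trans = ≈-trans }
                  ; ∙-cong = add-cong }
                ; assoc = add-assoc }
              ; identity = add-identityˡ , add-identityʳ }
            ; inverse = neg-inverseˡ , neg-inverseʳ
            ; ⁻¹-cong = neg-cong }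
          ; comm = add-comm }
        ; *-cong = mul-cong
        ; *-assoc = mul-assoc
        ; *-identity = mul-identityˡ , (λ p → ≈-trans (mul-comm p oneP) (mul-identityˡ p))
        ; distrib = (λ p q r → ≈-trans (mul-comm p (addP q r)) (≈-trans (mul-distribʳ q r p) (add-cong (mul-comm q p) (mul-comm r p))))
                  , (λ p q r → mul-distribʳ q r p) }
      ; *-comm = mul-comm }
    }

  module ≈-Reasoning = SetoidReasoning (CommutativeRing.setoid commutativeRing)

  ≡⇒≈ : ∀ {p q} → p ≡ q → p ≈ q
  ≡⇒≈ refl = ≈-refl

  const : ℤ → Poly
  const c = c ∷ []

  private
    const-homomorphism : CommutativeRing.rawRing ℤP.+-*-commutativeRing -Raw-AlmostCommutative⟶ fromCommutativeRing commutativeRing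
    const-homomorphism = record
      { ⟦_⟧ = const
      ; +-homo = λ a b → ≈-refl
      ; *-homo = λ a b → mk≈ λ { zero → sym (ℤP.+-identityʳ (a * b)) ; (suc i) → refl }
      ; -‿homo = λ a → ≈-refl
      ; 0-homo = mk≈ λ { zero → refl ; (suc i) → refl }
      ; 1-homo = ≈-refl
      }

    const-≈? : ∀ a b → Maybe (const a ≈ const b)
    const-≈? a b with a ℤ.≟ b
    ... | yes refl = just ≈-refl
    ... | no _ = nothing

  module Solver = RingSolver (CommutativeRing.rawRing ℤP.+-*-commutativeRing)
    (fromCommutativeRing commutativeRing) const-homomorphism const-≈?

module MonicDivision where

  open import Defs
  open Polynomial
  open import Data.Nat as ℕ using (ℕ; zero; suc; _≤ᵇ_; _∸_; _≤_; _<_; s≤s)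
  import Data.Nat.Properties as ℕP
  open import Data.Integer as ℤ using (ℤ; +_; _+_; _*_; -_; _-_)
  import Data.Integer.Properties as ℤP
  open import Data.List using (List; []; _∷_; length; reverse; _++_; foldl)
  open import Data.List.Properties using (++-identityʳ; reverse-++; reverse-involutive; length-reverse; unfold-reverse)
  open import Data.Bool using (true; false; if_then_else_; T)
  open import Data.Bool.Properties using (T-≡)
  open import Data.Product using (Σ; _×_; _,_)
  open import Data.Sum using ([_,_]′)
  open import Function using (id)
  open import Data.Empty using (⊥-elim)
  open import Function.Bundles using (Equivalence)
  open import Relation.Binary.PropositionalEquality
  open import Relation.Nullary using (yes; no)
  open Solver using (solve; _:+_; _:*_; _:-_; _:=_)

  mono : ℤ → ℕ → Poly
  mono a zero = a ∷ []
  mono a (suc k) = + 0 ∷ mono a k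

  X^ : ℕ → Poly
  X^ k = mono (+ 1) k

  shiftN : ℕ → Poly → Poly
  shiftN zero p = p
  shiftN (suc k) p = shift (shiftN k p)

  shiftN-cong : ∀ k {p q} → p ≈ q → shiftN k p ≈ shiftN k q
  shiftN-cong zero e = e
  shiftN-cong (suc k) e = shift-cong (shiftN-cong k e)

  mono-mulˡ : ∀ a k q → mulP (mono a k) q ≈ shiftN k (scaleP a q)
  mono-mulˡ a zero q = mk≈ λ i → trans (coeff-mul-cons a [] q i) (trans (cong (λ z → a * coeff q i + z) (coeff-shift[] i)) (trans (ℤP.+-identityʳ _) (sym (coeff-scale a q i))))
  mono-mulˡ a (suc k) q = ≈-trans (mul-shiftˡ (mono a k) q) (shift-cong (mono-mulˡ a k q))

  scale-mono : ∀ a b l → scaleP a (mono b l) ≈ mono (a * b) l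
  scale-mono a b zero = ≈-refl
  scale-mono a b (suc l) = mk≈ h
    where
    h : scaleP a (mono b (suc l)) ≋ mono (a * b) (suc l)
    h zero = ℤP.*-zeroʳ a
    h (suc i) = at (scale-mono a b l) i

  shiftN-mono : ∀ k c l → shiftN k (mono c l) ≈ mono c (k ℕ.+ l)
  shiftN-mono zero c l = ≈-refl
  shiftN-mono (suc k) c l = shift-cong (shiftN-mono k c l)

  mono-mono : ∀ a k b l → mulP (mono a k) (mono b l) ≈ mono (a * b) (k ℕ.+ l)
  mono-mono a k b l = ≈-trans (mono-mulˡ a k (mono b l)) (≈-trans (shiftN-cong k (scale-mono a b l)) (shiftN-mono k (a * b) l))

  mono-add : ∀ a b k → mono (a + b) k ≈ addP (mono a k) (mono b k)
  mono-add a b zero = ≈-refl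
  mono-add a b (suc k) = mk≈ h
    where
    h : mono (a + b) (suc k) ≋ addP (mono a (suc k)) (mono b (suc k))
    h zero = refl
    h (suc i) = at (mono-add a b k) i

  mono-neg : ∀ a k → mono (- a) k ≈ negP (mono a k)
  mono-neg a zero = ≈-refl
  mono-neg a (suc k) = mk≈ h
    where
    h : mono (- a) (suc k) ≋ negP (mono a (suc k))
    h zero = refl
    h (suc i) = at (mono-neg a k) i

  mono-sub : ∀ a b k → mono (a - b) k ≈ subP (mono a k) (mono b k)
  mono-sub a b k = ≈-trans (mono-add a (- b) k) (add-cong (≈-refl {mono a k}) (mono-neg b k))

  X^-add : ∀ a b → mulP (X^ a) (X^ b) ≈ X^ (a ℕ.+ b)
  X^-add a b = mono-mono (+ 1) a (+ 1) b

  snoc≈ : ∀ xs a → xs ++ (a ∷ []) ≈ addP xs (mono a (length xs))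
  snoc≈ [] a = ≈-refl
  snoc≈ (x ∷ xs) a = mk≈ h
    where
    h : (x ∷ xs) ++ (a ∷ []) ≋ addP (x ∷ xs) (mono a (length (x ∷ xs)))
    h zero = sym (ℤP.+-identityʳ x)
    h (suc i) = at (snoc≈ xs a) i

  sub≈[]⇒≈ : ∀ {p q} → subP p q ≈ [] → p ≈ q
  sub≈[]⇒≈ {p} {q} e = ≈-trans (≈-sym (sub-add p q)) (add-cong e (≈-refl {q}))
    where
    sub-add : ∀ p q → addP (subP p q) q ≈ p
    sub-add = solve 2 (λ p q → (p :- q) :+ q := p) ≈-refl

  ≈⇒sub≈[] : ∀ {p q} → p ≈ q → subP p q ≈ []
  ≈⇒sub≈[] {p} {q} e = ≈-trans (add-cong e (≈-refl {negP q})) (neg-inverseʳ q)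

  DegBelow : ℕ → Poly → Set
  DegBelow D r = ∀ i → D ≤ i → coeff r i ≡ + 0

  degBelow-cong : ∀ {D p q} → p ≈ q → DegBelow D p → DegBelow D q
  degBelow-cong e v i le = trans (sym (at e i)) (v i le)

  degBelow-mono : ∀ {D E p} → D ≤ E → DegBelow D p → DegBelow E p
  degBelow-mono le v i le2 = v i (ℕP.≤-trans le le2)

  degBelow-length : ∀ p → DegBelow (length p) p
  degBelow-length [] i le = refl
  degBelow-length (a ∷ p) (suc i) (s≤s le) = degBelow-length p i le

  degBelow-≈[] : ∀ {D p} → p ≈ [] → DegBelow D p
  degBelow-≈[] e i _ = at e i

  Monic : ℕ → Poly → Set
  Monic D p = Σ (List ℤ) (λ bs → length bs ≡ D × p ≡ bs ++ (+ 1 ∷ []))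

  coeff-++ʳ : ∀ (bs ys : List ℤ) j → coeff (bs ++ ys) (length bs ℕ.+ j) ≡ coeff ys j
  coeff-++ʳ [] ys j = refl
  coeff-++ʳ (b ∷ bs) ys j = coeff-++ʳ bs ys j

  length-snoc : ∀ (bs : List ℤ) a → length (bs ++ (a ∷ [])) ≡ suc (length bs)
  length-snoc [] a = refl
  length-snoc (b ∷ bs) a = cong suc (length-snoc bs a)

  monic-coeff : ∀ {D g} → Monic D g → coeff g D ≡ + 1
  monic-coeff (bs , refl , refl) = trans (cong (coeff (bs ++ (+ 1 ∷ []))) (sym (ℕP.+-identityʳ (length bs)))) (coeff-++ʳ bs (+ 1 ∷ []) 0)

  monic-length : ∀ {D g} → Monic D g → length g ≡ suc D
  monic-length (bs , refl , refl) = length-snoc bs (+ 1)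

  monic-degBelow : ∀ {D g} → Monic D g → DegBelow (suc D) g
  monic-degBelow {D} {g} mg = subst (λ n → DegBelow n g) (monic-length mg) (degBelow-length g)

  monic-intro : ∀ D p → length p ≡ suc D → coeff p D ≡ + 1 → Monic D p
  monic-intro zero (x ∷ []) refl refl = [] , refl , refl
  monic-intro (suc D) (x ∷ p) len c with monic-intro D p (ℕP.suc-injective len) c
  ... | bs , refl , refl = (x ∷ bs) , refl , refl

  degBelow-*-monic⇒≈[] : ∀ {D m} → Monic D m → ∀ h → DegBelow D (mulP h m) → h ≈ []
  degBelow-*-monic⇒≈[] mm [] v = ≈-refl
  degBelow-*-monic⇒≈[] {D} {m} mm (h₀ ∷ h) v = mk≈ λ { zero → h₀≡0 ; (suc i) → at h≈[] i }
    where
    h≈[] : h ≈ []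
    h≈[] = degBelow-*-monic⇒≈[] mm h λ i le →
      begin
        coeff (mulP h m) i
      ≡⟨ sym (ℤP.+-identityˡ _) ⟩
        + 0 + coeff (mulP h m) i
      ≡⟨ cong (_+ coeff (mulP h m) i) (sym (trans (cong (h₀ *_) (monic-degBelow mm (suc i) (s≤s le))) (ℤP.*-zeroʳ h₀))) ⟩
        h₀ * coeff m (suc i) + coeff (mulP h m) i
      ≡⟨ sym (coeff-mul-cons h₀ h m (suc i)) ⟩
        coeff (mulP (h₀ ∷ h) m) (suc i)
      ≡⟨ v (suc i) (ℕP.m≤n⇒m≤1+n le) ⟩
        + 0
      ∎
      where open ≡-Reasoning
    h₀≡0 : h₀ ≡ + 0
    h₀≡0 =
      begin
        h₀
      ≡⟨ ℤP.*-identityʳ h₀ ⟨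
        h₀ * + 1
      ≡⟨ cong (h₀ *_) (monic-coeff mm) ⟨
        h₀ * coeff m D
      ≡⟨ ℤP.+-identityʳ _ ⟨
        h₀ * coeff m D + + 0
      ≡⟨ cong (λ z → h₀ * coeff m D + z) (trans (at (shift-cong (mul-zeroˡ m h≈[])) D) (coeff-shift[] D)) ⟨
        h₀ * coeff m D + coeff (shift (mulP h m)) D
      ≡⟨ coeff-mul-cons h₀ h m D ⟨
        coeff (mulP (h₀ ∷ h) m) D
      ≡⟨ v D ℕP.≤-refl ⟩
        + 0
      ∎
      where open ≡-Reasoning

  monic-cancelˡ : ∀ {D m} → Monic D m → ∀ a b → mulP m a ≈ mulP m b → a ≈ b
  monic-cancelˡ mm a b e = sub≈[]⇒≈ (degBelow-*-monic⇒≈[] mm (subP a b) (degBelow-≈[] (≈-trans (factor a b _) (≈⇒sub≈[] e))))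
    where
    factor : ∀ a b m → mulP (subP a b) m ≈ subP (mulP m a) (mulP m b)
    factor = solve 3 (λ a b m → (a :- b) :* m := m :* a :- m :* b) ≈-refl

  -- Defs keeps its long division private, so it is restated here and identified with quotMonic below.
  subtractScaled : ℤ → List ℤ → List ℤ → List ℤ
  subtractScaled a []       as       = as
  subtractScaled a (b ∷ bs) []       = []
  subtractScaled a (b ∷ bs) (x ∷ xs) = (x - a * b) ∷ subtractScaled a bs xs

  divideHigh : ℕ → List ℤ → List ℤ → List ℤ
  divideHigh zero    bs _        = []
  divideHigh (suc k) bs []       = []
  divideHigh (suc k) bs (a ∷ as) =
    if length bs ≤ᵇ length as then a ∷ divideHigh k bs (subtractScaled a bs as) else []

  tail : List ℤ → List ℤ
  tail []       = []
  tail (_ ∷ xs) = xs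

  longQuotient : Poly → Poly → Poly
  longQuotient f g = reverse (divideHigh (length f) (tail (reverse g)) (reverse f))

  private
    module _ (F : ℕ → List ℤ → List ℤ → List ℤ) (S : ℤ → List ℤ → List ℤ → List ℤ)
      (F-zero : ∀ bs as → F 0 bs as ≡ [])
      (F-[] : ∀ k bs → F (suc k) bs [] ≡ [])
      (F-∷ : ∀ k bs a as → F (suc k) bs (a ∷ as) ≡ (if length bs ≤ᵇ length as then a ∷ F k bs (S a bs as) else []))
      (S-[] : ∀ a as → S a [] as ≡ as)
      (S-∷[] : ∀ a b bs → S a (b ∷ bs) [] ≡ [])
      (S-∷∷ : ∀ a b bs x xs → S a (b ∷ bs) (x ∷ xs) ≡ (x - a * b) ∷ S a bs xs) where

      S≗subtractScaled : ∀ a bs as → S a bs as ≡ subtractScaled a bs as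
      S≗subtractScaled a [] as = S-[] a as
      S≗subtractScaled a (b ∷ bs) [] = S-∷[] a b bs
      S≗subtractScaled a (b ∷ bs) (x ∷ xs) = trans (S-∷∷ a b bs x xs) (cong ((x - a * b) ∷_) (S≗subtractScaled a bs xs))

      F≗divideHigh : ∀ k bs as → F k bs as ≡ divideHigh k bs as
      F≗divideHigh zero bs as = F-zero bs as
      F≗divideHigh (suc k) bs [] = F-[] k bs
      F≗divideHigh (suc k) bs (a ∷ as) = trans (F-∷ k bs a as)
        (cong (λ z → if length bs ≤ᵇ length as then a ∷ z else [])
              (trans (F≗divideHigh k bs (S a bs as)) (cong (divideHigh k bs) (S≗subtractScaled a bs as))))

  -- F and S are solved by the private functions of Defs; the with-abstractions turn their
  -- arguments into variables, which is what lets unification find them.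
  quotMonic≡longQuotient : ∀ f g → quotMonic f g ≡ longQuotient f g
  quotMonic≡longQuotient f g with F≗divideHigh _ _ (λ _ _ → refl) (λ _ _ → refl) (λ _ _ _ _ → refl) (λ _ _ → refl) (λ _ _ _ → refl) (λ _ _ _ _ _ → refl)
  ... | F≗ rewrite sym (++-identityʳ f) with length (f ++ []) | reverse (f ++ []) | reverse g
  ... | k | rf | []     with foldl (λ (ys : List ℤ) (y : ℤ) → y ∷ ys) []
  ...   | rev = cong rev (F≗ k [] rf)
  quotMonic≡longQuotient f g | F≗ | k | rf | _ ∷ bs with foldl (λ (ys : List ℤ) (y : ℤ) → y ∷ ys) []
  ...   | rev = cong rev (F≗ k bs rf)

  highFirst : List ℤ → Poly
  highFirst [] = []
  highFirst (a ∷ as) = addP (mono a (length as)) (highFirst as)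

  highFirst≈reverse : ∀ as → highFirst as ≈ reverse as
  highFirst≈reverse [] = ≈-refl
  highFirst≈reverse (a ∷ as) =
    begin
      addP (mono a (length as)) (highFirst as)
    ≈⟨ add-cong (≈-refl {mono a (length as)}) (highFirst≈reverse as) ⟩
      addP (mono a (length as)) (reverse as)
    ≈⟨ add-comm (mono a (length as)) (reverse as) ⟩
      addP (reverse as) (mono a (length as))
    ≡⟨ cong (λ n → addP (reverse as) (mono a n)) (length-reverse as) ⟨
      addP (reverse as) (mono a (length (reverse as)))
    ≈⟨ snoc≈ (reverse as) a ⟨
      reverse as ++ (a ∷ [])
    ≡⟨ unfold-reverse a as ⟨
      reverse (a ∷ as)
    ∎
    where open ≈-Reasoning

  degBelow-highFirst : ∀ as → DegBelow (length as) (highFirst as)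
  degBelow-highFirst as = degBelow-cong (≈-sym (highFirst≈reverse as)) (subst (λ n → DegBelow n (reverse as)) (length-reverse as) (degBelow-length (reverse as)))

  length-subtractScaled : ∀ a bs xs → length (subtractScaled a bs xs) ≡ length xs
  length-subtractScaled a [] xs = refl
  length-subtractScaled a (b ∷ bs) [] = refl
  length-subtractScaled a (b ∷ bs) (x ∷ xs) = cong suc (length-subtractScaled a bs xs)

  highFirst-subtractScaled : ∀ a bs xs → length bs ≤ length xs →
    highFirst (subtractScaled a bs xs) ≈ subP (highFirst xs) (mulP (mono a (length xs ∸ length bs)) (highFirst bs))
  highFirst-subtractScaled a [] xs le = ≈-sym (≈-trans (sub-cong (≈-refl {highFirst xs}) (mul-zeroʳ (mono a (length xs ∸ 0)))) (add-identityʳ (highFirst xs)))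
  highFirst-subtractScaled a (b ∷ bs) (x ∷ xs) (s≤s le) =
    begin
      addP (mono (x - a * b) (length (subtractScaled a bs xs))) (highFirst (subtractScaled a bs xs))
    ≈⟨ add-cong (≡⇒≈ (cong (mono (x - a * b)) (length-subtractScaled a bs xs))) (highFirst-subtractScaled a bs xs le) ⟩
      addP (mono (x - a * b) n) (subP (highFirst xs) (mulP (mono a k) (highFirst bs)))
    ≈⟨ add-cong (≈-trans (mono-sub x (a * b) n) (sub-cong (≈-refl {mono x n}) (≈-sym (≈-trans (mono-mono a k b l) (≡⇒≈ (cong (mono (a * b)) (ℕP.m∸n+n≡m le)))))))
                (≈-refl {subP (highFirst xs) (mulP (mono a k) (highFirst bs))}) ⟩
      addP (subP (mono x n) (mulP (mono a k) (mono b l))) (subP (highFirst xs) (mulP (mono a k) (highFirst bs)))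
    ≈⟨ regroup (mono x n) (mono a k) (mono b l) (highFirst xs) (highFirst bs) ⟩
      subP (addP (mono x n) (highFirst xs)) (mulP (mono a k) (addP (mono b l) (highFirst bs)))
    ∎
    where
    open ≈-Reasoning
    n = length xs
    l = length bs
    k = n ∸ l
    regroup : ∀ A M Mb P Q → addP (subP A (mulP M Mb)) (subP P (mulP M Q)) ≈ subP (addP A P) (mulP M (addP Mb Q))
    regroup = solve 5 (λ A M Mb P Q → (A :- M :* Mb) :+ (P :- M :* Q) := (A :+ P) :- M :* (Mb :+ Q)) ≈-refl

  ≤ᵇ≡true⇒≤ : ∀ m n → (m ≤ᵇ n) ≡ true → m ≤ n
  ≤ᵇ≡true⇒≤ m n eq = ℕP.≤ᵇ⇒≤ m n (Equivalence.from T-≡ eq)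

  ≤ᵇ≡false⇒> : ∀ m n → (m ≤ᵇ n) ≡ false → n < m
  ≤ᵇ≡false⇒> m n eq = ℕP.≰⇒> (λ m≤n → subst T eq (ℕP.≤⇒≤ᵇ m≤n))

  length-divideHigh : ∀ k bs as → length as ≤ k → length (divideHigh k bs as) ≡ length as ∸ length bs
  length-divideHigh zero bs [] le = sym (ℕP.0∸n≡0 (length bs))
  length-divideHigh (suc k) bs [] le = sym (ℕP.0∸n≡0 (length bs))
  length-divideHigh (suc k) bs (a ∷ as) (s≤s le) with length bs ≤ᵇ length as in eq
  ... | true = trans (cong suc (trans (length-divideHigh k bs s (subst (_≤ k) (sym len-s) le)) (cong (_∸ length bs) len-s)))
                     (sym (ℕP.+-∸-assoc 1 (≤ᵇ≡true⇒≤ (length bs) (length as) eq)))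
    where
    s = subtractScaled a bs as
    len-s = length-subtractScaled a bs as
  ... | false = sym (ℕP.m≤n⇒m∸n≡0 (≤ᵇ≡false⇒> (length bs) (length as) eq))

  divideHigh-remainder : ∀ k bs as → length as ≤ k →
    DegBelow (length bs) (subP (highFirst as) (mulP (highFirst (+ 1 ∷ bs)) (highFirst (divideHigh k bs as))))
  divideHigh-remainder zero bs [] le = degBelow-≈[] (≈-trans (sub-cong (≈-refl {[]}) (mul-zeroʳ (highFirst (+ 1 ∷ bs)))) (add-identityʳ []))
  divideHigh-remainder (suc k) bs [] le = degBelow-≈[] (≈-trans (sub-cong (≈-refl {[]}) (mul-zeroʳ (highFirst (+ 1 ∷ bs)))) (add-identityʳ []))
  divideHigh-remainder (suc k) bs (a ∷ as) (s≤s le) with length bs ≤ᵇ length as in eq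
  ... | true = degBelow-cong same-remainder (divideHigh-remainder k bs s (subst (_≤ k) (sym (length-subtractScaled a bs as)) le))
    where
    s = subtractScaled a bs as
    q = divideHigh k bs s
    D = length bs
    L = length as
    j = L ∸ D
    m = addP (X^ D) (highFirst bs)
    D≤L : D ≤ L
    D≤L = ≤ᵇ≡true⇒≤ D L eq
    length-q : length q ≡ j
    length-q = trans (length-divideHigh k bs s (subst (_≤ k) (sym (length-subtractScaled a bs as)) le)) (cong (_∸ D) (length-subtractScaled a bs as))
    leading : mulP (X^ D) (mono a j) ≈ mono a L
    leading = ≈-trans (mono-mono (+ 1) D a j) (≈-trans (≡⇒≈ (cong (λ c → mono c (D ℕ.+ j)) (ℤP.*-identityˡ a))) (≡⇒≈ (cong (mono a) (ℕP.m+[n∸m]≡n D≤L))))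
    regroup : ∀ ML E X B MJ Q → subP (addP ML E) (mulP (addP X B) (addP MJ Q)) ≈ addP (subP ML (mulP X MJ)) (subP (subP E (mulP MJ B)) (mulP (addP X B) Q))
    regroup = solve 6 (λ ML E X B MJ Q → (ML :+ E) :- (X :+ B) :* (MJ :+ Q) := (ML :- X :* MJ) :+ ((E :- MJ :* B) :- (X :+ B) :* Q)) ≈-refl
    same-remainder : subP (highFirst s) (mulP m (highFirst q)) ≈ subP (highFirst (a ∷ as)) (mulP m (highFirst (a ∷ q)))
    same-remainder =
      begin
        subP (highFirst s) (mulP m (highFirst q))
      ≈⟨ sub-cong (highFirst-subtractScaled a bs as D≤L) (≈-refl {mulP m (highFirst q)}) ⟩
        subP (subP (highFirst as) (mulP (mono a j) (highFirst bs))) (mulP m (highFirst q))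
      ≈⟨ add-cong (≈⇒sub≈[] (≈-sym leading)) (≈-refl {subP (subP (highFirst as) (mulP (mono a j) (highFirst bs))) (mulP m (highFirst q))}) ⟨
        addP (subP (mono a L) (mulP (X^ D) (mono a j))) (subP (subP (highFirst as) (mulP (mono a j) (highFirst bs))) (mulP m (highFirst q)))
      ≈⟨ regroup (mono a L) (highFirst as) (X^ D) (highFirst bs) (mono a j) (highFirst q) ⟨
        subP (addP (mono a L) (highFirst as)) (mulP m (addP (mono a j) (highFirst q)))
      ≡⟨ cong (λ n → subP (highFirst (a ∷ as)) (mulP m (addP (mono a n) (highFirst q)))) (sym length-q) ⟩
        subP (highFirst (a ∷ as)) (mulP m (highFirst (a ∷ q)))
      ∎
      where open ≈-Reasoning
  ... | false = degBelow-mono {p = subP (highFirst (a ∷ as)) (mulP (highFirst (+ 1 ∷ bs)) [])} (≤ᵇ≡false⇒> (length bs) (length as) eq)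
                 (degBelow-cong {p = highFirst (a ∷ as)} (≈-sym (≈-trans (sub-cong (≈-refl {highFirst (a ∷ as)}) (mul-zeroʳ (highFirst (+ 1 ∷ bs)))) (add-identityʳ (highFirst (a ∷ as)))))
                   (degBelow-highFirst (a ∷ as)))

  longQuotient-remainder : ∀ {D} f g → Monic D g → DegBelow D (subP f (mulP g (longQuotient f g)))
  longQuotient-remainder f .(bs ++ (+ 1 ∷ [])) (bs , refl , refl) rewrite reverse-++ bs (+ 1 ∷ []) =
    subst (λ n → DegBelow n (subP f (mulP (bs ++ (+ 1 ∷ [])) (reverse q)))) (length-reverse bs)
      (degBelow-cong {p = subP (highFirst (reverse f)) (mulP (highFirst (+ 1 ∷ reverse bs)) (highFirst q))}
        (sub-cong (≈-trans (highFirst≈reverse (reverse f)) (≡⇒≈ (reverse-involutive f)))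
                  (mul-cong (≈-trans (highFirst≈reverse (+ 1 ∷ reverse bs)) (≡⇒≈ (trans (cong reverse (sym (reverse-++ bs (+ 1 ∷ [])))) (reverse-involutive (bs ++ (+ 1 ∷ []))))))
                            (highFirst≈reverse q)))
        (divideHigh-remainder (length f) (reverse bs) (reverse f) (ℕP.≤-reflexive (length-reverse f))))
    where
    q = divideHigh (length f) (reverse bs) (reverse f)

  longQuotient-monic : ∀ {D E f g} → Monic E f → Monic D g → D ≤ E → Monic (E ∸ D) (longQuotient f g)
  longQuotient-monic {f = .(cs ++ (+ 1 ∷ []))} {g = .(bs ++ (+ 1 ∷ []))} (cs , refl , refl) (bs , refl , refl) le
    rewrite length-snoc cs (+ 1) | reverse-++ cs (+ 1 ∷ []) | reverse-++ bs (+ 1 ∷ [])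
    with length (reverse bs) ℕ.≤ᵇ length (reverse cs) in eq
  ... | true = reverse q , trans (length-reverse q) length-q , unfold-reverse (+ 1) q
    where
    s = subtractScaled (+ 1) (reverse bs) (reverse cs)
    q = divideHigh (length cs) (reverse bs) s
    length-s : length s ≡ length cs
    length-s = trans (length-subtractScaled (+ 1) (reverse bs) (reverse cs)) (length-reverse cs)
    length-q : length q ≡ length cs ∸ length bs
    length-q = trans (length-divideHigh (length cs) (reverse bs) s (ℕP.≤-reflexive length-s)) (cong₂ _∸_ length-s (length-reverse bs))
  ... | false = ⊥-elim (ℕP.<⇒≱ (≤ᵇ≡false⇒> (length (reverse bs)) (length (reverse cs)) eq) (subst₂ _≤_ (sym (length-reverse bs)) (sym (length-reverse cs)) le))

  longQuotient-exact : ∀ {D g} → Monic D g → ∀ f h → mulP g h ≈ f → mulP g (longQuotient f g) ≈ f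
  longQuotient-exact {D} {g} mg f h e = ≈-trans (mul-congʳ g (≈-sym h≈q)) e
    where
    q = longQuotient f g
    rearrange : ∀ g h q → subP (mulP g h) (mulP g q) ≈ mulP (subP h q) g
    rearrange = solve 3 (λ g h q → g :* h :- g :* q := (h :- q) :* g) ≈-refl
    h≈q : h ≈ q
    h≈q = sub≈[]⇒≈ (degBelow-*-monic⇒≈[] mg (subP h q)
            (degBelow-cong (≈-trans (sub-cong (≈-sym e) (≈-refl {mulP g q})) (rearrange g h q)) (longQuotient-remainder f g mg)))

  coeff-const-mul : ∀ N r i → coeff (mulP (const N) r) i ≡ N * coeff r i
  coeff-const-mul N r i = trans (coeff-mul-cons N [] r i) (trans (cong (λ z → N * coeff r i + z) (coeff-shift[] i)) (ℤP.+-identityʳ _))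

  longQuotient-exact-scaled : ∀ {D m} → Monic D m → ∀ h N c → mulP m h ≈ mulP (const N) c → N ≢ + 0 → mulP m (longQuotient c m) ≈ c
  longQuotient-exact-scaled {D} {m} mm h N c e N≢0 = ≈-sym (sub≈[]⇒≈ r≈[])
    where
    t = longQuotient c m
    r = subP c (mulP m t)
    rearrange : ∀ N c m t h → mulP m h ≈ mulP N c → mulP N (subP c (mulP m t)) ≈ mulP (subP h (mulP N t)) m
    rearrange N c m t h e = ≈-trans (expand N c m t) (≈-trans (sub-cong (≈-sym e) (≈-refl {mulP N (mulP m t)})) (collect N m t h))
      where
      expand : ∀ N c m t → mulP N (subP c (mulP m t)) ≈ subP (mulP N c) (mulP N (mulP m t))
      expand = solve 4 (λ N c m t → N :* (c :- m :* t) := N :* c :- N :* (m :* t)) ≈-refl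
      collect : ∀ N m t h → subP (mulP m h) (mulP N (mulP m t)) ≈ mulP (subP h (mulP N t)) m
      collect = solve 4 (λ N m t h → m :* h :- N :* (m :* t) := (h :- N :* t) :* m) ≈-refl
    Nr≈ : mulP (const N) r ≈ mulP (subP h (mulP (const N) t)) m
    Nr≈ = rearrange (const N) c m t h e
    degBelow-Nr : DegBelow D (mulP (const N) r)
    degBelow-Nr i le = trans (coeff-const-mul N r i) (trans (cong (N *_) (longQuotient-remainder c m mm i le)) (ℤP.*-zeroʳ N))
    Nr≈[] : mulP (const N) r ≈ []
    Nr≈[] = ≈-trans Nr≈ (mul-zeroˡ m (degBelow-*-monic⇒≈[] mm (subP h (mulP (const N) t)) (degBelow-cong Nr≈ degBelow-Nr)))
    r≈[] : r ≈ []
    r≈[] = mk≈ λ i → [ (λ N≡0 → ⊥-elim (N≢0 N≡0)) , id ]′ (ℤP.i*j≡0⇒i≡0∨j≡0 N (trans (sym (coeff-const-mul N r i)) (at Nr≈[] i)))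

  monic-∣-monic⇒≤ : ∀ {D E g f h} → Monic D g → mulP g h ≈ f → Monic E f → D ≤ E
  monic-∣-monic⇒≤ {D} {E} {g} {f} {h} mg e mf with D ℕP.≤? E
  ... | yes D≤E = D≤E
  ... | no D≰E = ⊥-elim (1≢0 (begin
        + 1                 ≡⟨ monic-coeff mf ⟨
        coeff f E           ≡⟨ at e E ⟨
        coeff (mulP g h) E  ≡⟨ at (mul-comm g h) E ⟩
        coeff (mulP h g) E  ≡⟨ at (mul-zeroˡ g h≈[]) E ⟩
        + 0                 ∎))
    where
    open ≡-Reasoning
    1≢0 : + 1 ≢ + 0
    1≢0 ()
    h≈[] : h ≈ []
    h≈[] = degBelow-*-monic⇒≈[] mg h (degBelow-cong (≈-sym (≈-trans (mul-comm h g) e)) (degBelow-mono {p = f} (ℕP.≰⇒> D≰E) (monic-degBelow mf)))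

  monic-≈⇒≡ : ∀ {D E p q} → Monic D p → Monic E q → p ≈ q → D ≡ E
  monic-≈⇒≡ {p = p} {q} mp mq e =
    ℕP.≤-antisym (monic-∣-monic⇒≤ mp (≈-trans (mul-comm p oneP) (≈-trans (mul-identityˡ p) e)) mq)
                 (monic-∣-monic⇒≤ mq (≈-trans (mul-comm q oneP) (≈-trans (mul-identityˡ q) (≈-sym e))) mp)

module Divisibility where

  open import Defs
  open Polynomial
  open MonicDivision
  open import Data.Nat as ℕ using (ℕ; zero; suc; z≤n; s≤s; _⊔_)
  import Data.Nat.Properties as ℕP
  open import Data.Nat.GCD using (gcd; gcd-GCD; module Bézout)
  open import Data.Integer as ℤ using (ℤ; +_; _+_; _*_; -_)
  import Data.Integer.Properties as ℤP
  open import Data.List using ([]; _∷_; length; _++_; replicate)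
  open import Data.List.Properties using (length-map; length-replicate)
  open import Data.Product using (Σ; _×_; _,_)
  open import Data.Sum using (inj₁; inj₂)
  open import Relation.Binary.PropositionalEquality
  open Solver using (solve; _:+_; _:*_; _:-_; :-_; _:=_; con)

  length-addP : ∀ p q → length (addP p q) ≡ length p ⊔ length q
  length-addP [] q = refl
  length-addP (a ∷ p) [] = refl
  length-addP (a ∷ p) (b ∷ q) = cong suc (length-addP p q)

  length-mul : ∀ a b p q → length p ≡ suc a → length q ≡ suc b → length (mulP p q) ≡ suc (a ℕ.+ b)
  length-mul zero b (x ∷ []) q lp lq =
    trans (length-addP (scaleP x q) (+ 0 ∷ [])) (trans (cong (λ z → z ⊔ 1) (trans (length-map (x *_) q) lq)) (cong suc (ℕP.⊔-identityʳ b)))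
  length-mul (suc a) b (x ∷ y ∷ p) q lp lq =
    trans (length-addP (scaleP x q) (+ 0 ∷ mulP (y ∷ p) q))
      (trans (cong₂ _⊔_ (trans (length-map (x *_) q) lq) (cong suc (length-mul a b (y ∷ p) q (ℕP.suc-injective lp) lq)))
        (cong suc (ℕP.m≤n⇒m⊔n≡n (ℕP.≤-trans (ℕP.m≤n+m b a) (ℕP.n≤1+n (a ℕ.+ b))))))

  coeff-mul-leading : ∀ a b p q → DegBelow (suc a) p → DegBelow (suc b) q → coeff (mulP p q) (a ℕ.+ b) ≡ coeff p a * coeff q b
  coeff-mul-leading a b [] q vp vq = sym (ℤP.*-zeroˡ (coeff q b))
  coeff-mul-leading zero b (x ∷ p) q vp vq =
    trans (coeff-mul-cons x p q b) (trans (cong (λ z → x * coeff q b + z) (sh b)) (ℤP.+-identityʳ _))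
    where
    p0 : p ≈ []
    p0 = mk≈ λ i → vp (suc i) (s≤s z≤n)
    sh : ∀ i → coeff (shift (mulP p q)) i ≡ + 0
    sh zero = refl
    sh (suc i) = at (mul-zeroˡ q p0) i
  coeff-mul-leading (suc a) b (x ∷ p) q vp vq =
    trans (coeff-mul-cons x p q (suc a ℕ.+ b))
      (trans (cong (λ z → x * z + coeff (mulP p q) (a ℕ.+ b)) (vq (suc a ℕ.+ b) (s≤s (ℕP.m≤n+m b a))))
        (trans (cong (λ z → z + coeff (mulP p q) (a ℕ.+ b)) (ℤP.*-zeroʳ x))
          (trans (ℤP.+-identityˡ _) (coeff-mul-leading a b p q (λ i le → vp (suc i) (s≤s le)) vq))))

  monic-mul : ∀ {a b p q} → Monic a p → Monic b q → Monic (a ℕ.+ b) (mulP p q)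
  monic-mul {a} {b} {p} {q} mp mq =
    monic-intro (a ℕ.+ b) (mulP p q) (length-mul a b p q (monic-length mp) (monic-length mq))
      (trans (coeff-mul-leading a b p q (monic-degBelow mp) (monic-degBelow mq)) (cong₂ _*_ (monic-coeff mp) (monic-coeff mq)))

  monic-one : Monic 0 oneP
  monic-one = [] , refl , refl

  X^-1 : ℕ → Poly
  X^-1 n = subP (X^ n) oneP

  replicate-snoc≡mono : ∀ k (a : ℤ) → replicate k (+ 0) ++ (a ∷ []) ≡ mono a k
  replicate-snoc≡mono zero a = refl
  replicate-snoc≡mono (suc k) a = cong (+ 0 ∷_) (replicate-snoc≡mono k a)

  monic-xpm1 : ∀ k → Monic (suc k) (xpm1 (suc k))
  monic-xpm1 k = ((- (+ 1)) ∷ replicate k (+ 0)) , cong suc (length-replicate k) , refl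

  xpm1≈X^-1 : ∀ n → xpm1 n ≈ X^-1 n
  xpm1≈X^-1 zero = ≈-sym (neg-inverseʳ oneP)
  xpm1≈X^-1 (suc k) rewrite replicate-snoc≡mono k (+ 1) = mk≈ λ
    { zero → refl
    ; (suc i) → sym (trans (coeff-add (mono (+ 1) k) [] i) (ℤP.+-identityʳ _)) }

  geometric : ℕ → ℕ → Poly
  geometric e zero = []
  geometric e (suc k) = addP (X^ (k ℕ.* e)) (geometric e k)

  geometric-spec : ∀ e k → X^-1 (k ℕ.* e) ≈ mulP (X^-1 e) (geometric e k)
  geometric-spec e zero = ≈-trans (neg-inverseʳ oneP) (≈-sym (mul-zeroʳ (X^-1 e)))
  geometric-spec e (suc k) =
    ≈-trans (sub-cong (≈-sym (X^-add e (k ℕ.* e))) (≈-refl {oneP}))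
      (≈-trans (split (X^ e) (X^ (k ℕ.* e)))
        (≈-trans (add-cong (≈-refl {mulP (X^-1 e) (X^ (k ℕ.* e))}) (geometric-spec e k))
          (factor (X^ e) (X^ (k ℕ.* e)) (geometric e k))))
    where
    split : ∀ Xe Xk → subP (mulP Xe Xk) oneP ≈ addP (mulP (subP Xe oneP) Xk) (subP Xk oneP)
    split = solve 2 (λ Xe Xk → Xe :* Xk :- con (+ 1) := (Xe :- con (+ 1)) :* Xk :+ (Xk :- con (+ 1))) ≈-refl
    factor : ∀ Xe Xk G → addP (mulP (subP Xe oneP) Xk) (mulP (subP Xe oneP) G) ≈ mulP (subP Xe oneP) (addP Xk G)
    factor = solve 3 (λ Xe Xk G → (Xe :- con (+ 1)) :* Xk :+ (Xe :- con (+ 1)) :* G := (Xe :- con (+ 1)) :* (Xk :+ G)) ≈-refl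

  geometricSums : ℕ → ℕ → Poly
  geometricSums e zero = []
  geometricSums e (suc k) = addP (geometric e k) (geometricSums e k)

  -- Each of the k summands of geometric e k is 1 modulo X^e - 1.
  geometricSums-spec : ∀ e k → subP (geometric e k) (const (+ k)) ≈ mulP (X^-1 e) (geometricSums e k)
  geometricSums-spec e zero = ≈-trans (mk≈ λ { zero → refl ; (suc i) → refl }) (≈-sym (mul-zeroʳ (X^-1 e)))
  geometricSums-spec e (suc k) =
    ≈-trans (sub-cong (≈-refl {geometric e (suc k)}) (mk≈ λ { zero → refl ; (suc i) → refl }))
      (≈-trans (regroup (X^ (k ℕ.* e)) (geometric e k) (const (+ k)))
        (≈-trans (add-cong (geometric-spec e k) (geometricSums-spec e k))
          (factor (X^ e) (geometric e k) (geometricSums e k))))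
    where
    regroup : ∀ Xk G K → subP (addP Xk G) (addP oneP K) ≈ addP (subP Xk oneP) (subP G K)
    regroup = solve 3 (λ Xk G K → (Xk :+ G) :- (con (+ 1) :+ K) := (Xk :- con (+ 1)) :+ (G :- K)) ≈-refl
    factor : ∀ Xe G W → addP (mulP (subP Xe oneP) G) (mulP (subP Xe oneP) W) ≈ mulP (subP Xe oneP) (addP G W)
    factor = solve 3 (λ Xe G W → (Xe :- con (+ 1)) :* G :+ (Xe :- con (+ 1)) :* W := (Xe :- con (+ 1)) :* (G :+ W)) ≈-refl

  infix 4 _∣≈_
  _∣≈_ : Poly → Poly → Set
  g ∣≈ f = Σ Poly (λ h → mulP g h ≈ f)

  ∣ₚ⇒∣≈ : ∀ {g f} → g ∣ₚ f → g ∣≈ f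
  ∣ₚ⇒∣≈ (h , eq) = h , mk≈ eq

  ∣≈⇒∣ₚ : ∀ {g f} → g ∣≈ f → g ∣ₚ f
  ∣≈⇒∣ₚ (h , eq) = h , at eq

  ∣≈-trans : ∀ {a b c} → a ∣≈ b → b ∣≈ c → a ∣≈ c
  ∣≈-trans {a} (h1 , e1) (h2 , e2) = mulP h1 h2 , ≈-trans (≈-sym (mul-assoc a h1 h2)) (≈-trans (mul-congˡ h2 e1) e2)

  ∣≈-respˡ : ∀ {a a′ c} → a ≈ a′ → a ∣≈ c → a′ ∣≈ c
  ∣≈-respˡ {a} {a′} eq (h , e) = h , ≈-trans (mul-congˡ h (≈-sym eq)) e

  xpm1-∣-xpm1-* : ∀ e k → xpm1 e ∣≈ xpm1 (k ℕ.* e)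
  xpm1-∣-xpm1-* e k = geometric e k ,
    ≈-trans (mul-congˡ (geometric e k) (xpm1≈X^-1 e)) (≈-trans (≈-sym (geometric-spec e k)) (≈-sym (xpm1≈X^-1 (k ℕ.* e))))

  -- Coprimality in ℚ[x], with the denominators of the Bézout coefficients cleared.
  Coprime : Poly → Poly → Set
  Coprime a b = Σ Poly (λ u → Σ Poly (λ v → Σ ℤ (λ N → N ≢ + 0 × addP (mulP u a) (mulP v b) ≈ const N)))

  coprime-sym : ∀ {a b} → Coprime a b → Coprime b a
  coprime-sym {a} {b} (u , v , N , N≢0 , e) = v , u , N , N≢0 , ≈-trans (add-comm (mulP v b) (mulP u a)) e

  coprime-oneʳ : ∀ a → Coprime a oneP
  coprime-oneʳ a = [] , oneP , + 1 , (λ ()) , mk≈ λ { zero → refl ; (suc i) → refl }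

  const-* : ∀ a b → mulP (const a) (const b) ≈ const (a * b)
  const-* a b = mk≈ λ { zero → ℤP.+-identityʳ (a * b) ; (suc i) → refl }

  coprime-*ʳ : ∀ {a b c} → Coprime a b → Coprime a c → Coprime a (mulP b c)
  coprime-*ʳ {a} {b} {c} (u₁ , v₁ , N₁ , N₁≢0 , e₁) (u₂ , v₂ , N₂ , N₂≢0 , e₂) =
    u , mulP v₁ v₂ , N₁ * N₂ , N₁N₂≢0 , ≈-trans (expand u₁ v₁ u₂ v₂ a b c) (≈-trans (mul-cong e₁ e₂) (const-* N₁ N₂))
    where
    u = addP (addP (mulP (mulP u₁ u₂) a) (mulP (mulP u₁ v₂) c)) (mulP (mulP v₁ b) u₂)
    expand : ∀ u₁ v₁ u₂ v₂ a b c → addP (mulP (addP (addP (mulP (mulP u₁ u₂) a) (mulP (mulP u₁ v₂) c)) (mulP (mulP v₁ b) u₂)) a) (mulP (mulP v₁ v₂) (mulP b c))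
                                ≈ mulP (addP (mulP u₁ a) (mulP v₁ b)) (addP (mulP u₂ a) (mulP v₂ c))
    expand = solve 7 (λ u₁ v₁ u₂ v₂ a b c → ((u₁ :* u₂) :* a :+ (u₁ :* v₂) :* c :+ (v₁ :* b) :* u₂) :* a :+ (v₁ :* v₂) :* (b :* c)
                      := (u₁ :* a :+ v₁ :* b) :* (u₂ :* a :+ v₂ :* c)) ≈-refl
    N₁N₂≢0 : N₁ * N₂ ≢ + 0
    N₁N₂≢0 e with ℤP.i*j≡0⇒i≡0∨j≡0 N₁ e
    ... | inj₁ N₁≡0 = N₁≢0 N₁≡0
    ... | inj₂ N₂≡0 = N₂≢0 N₂≡0

  coprime-∣-∣⇒*-∣ : ∀ {Da Db a b c} → Monic Da a → Monic Db b → a ∣≈ c → b ∣≈ c → Coprime a b → mulP a b ∣≈ c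
  coprime-∣-∣⇒*-∣ {Da} {Db} {a} {b} {c} ma mb (a′ , ea) (b′ , eb) (u , v , N , N≢0 , e) =
    longQuotient c (mulP a b) , longQuotient-exact-scaled (monic-mul ma mb) (addP (mulP u b′) (mulP v a′)) N c scaled N≢0
    where
    expand : ∀ a b u v a′ b′ → mulP (mulP a b) (addP (mulP u b′) (mulP v a′)) ≈ addP (mulP u (mulP a (mulP b b′))) (mulP v (mulP b (mulP a a′)))
    expand = solve 6 (λ a b u v a′ b′ → (a :* b) :* (u :* b′ :+ v :* a′) := u :* (a :* (b :* b′)) :+ v :* (b :* (a :* a′))) ≈-refl
    collect : ∀ a b u v c → addP (mulP u (mulP a c)) (mulP v (mulP b c)) ≈ mulP (addP (mulP u a) (mulP v b)) c
    collect = solve 5 (λ a b u v c → u :* (a :* c) :+ v :* (b :* c) := (u :* a :+ v :* b) :* c) ≈-refl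
    scaled : mulP (mulP a b) (addP (mulP u b′) (mulP v a′)) ≈ mulP (const N) c
    scaled = ≈-trans (expand a b u v a′ b′)
              (≈-trans (add-cong (mul-congʳ u (mul-congʳ a eb)) (mul-congʳ v (mul-congʳ b ea)))
                (≈-trans (collect a b u v c) (mul-congˡ c e)))

  Combination : ℕ → ℕ → ℕ → Set
  Combination a b g = Σ Poly (λ u → Σ Poly (λ v → addP (mulP u (X^-1 a)) (mulP v (X^-1 b)) ≈ X^-1 g))

  combination-sym : ∀ {a b g} → Combination a b g → Combination b a g
  combination-sym {a} {b} (u , v , e) = v , u , ≈-trans (add-comm (mulP v (X^-1 b)) (mulP u (X^-1 a))) e

  -- From d + y b = x a: X^d - 1 = (X^(x a) - 1) - X^d (X^(y b) - 1), and X^a - 1 divides X^(x a) - 1.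
  combination-of-identity : ∀ {d a b} x y → d ℕ.+ y ℕ.* b ≡ x ℕ.* a → Combination a b d
  combination-of-identity {d} {a} {b} x y eq =
    geometric a x , negP (mulP (X^ d) (geometric b y)) ,
    ≈-trans (add-cong (mul-comm (geometric a x) (X^-1 a)) (mul-congʳ (negP (mulP (X^ d) (geometric b y))) (≈-refl {X^-1 b})))
     (≈-trans (rearrange (X^-1 a) (geometric a x) (X^ d) (geometric b y) (X^-1 b))
      (≈-trans (sub-cong (≈-sym (geometric-spec a x)) (mul-congʳ (X^ d) (≈-sym (geometric-spec b y))))
       (≈-trans (sub-cong (≡⇒≈ (cong X^-1 (sym eq))) (≈-refl {mulP (X^ d) (X^-1 (y ℕ.* b))}))
        (≈-trans (sub-cong (sub-cong (≈-sym (X^-add d (y ℕ.* b))) (≈-refl {oneP})) (≈-refl {mulP (X^ d) (X^-1 (y ℕ.* b))}))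
         (cancel (X^ d) (X^ (y ℕ.* b)))))))
    where
    rearrange : ∀ A G D H B → addP (mulP A G) (mulP (negP (mulP D H)) B) ≈ subP (mulP A G) (mulP D (mulP B H))
    rearrange = solve 5 (λ A G D H B → A :* G :+ (:- (D :* H)) :* B := A :* G :- D :* (B :* H)) ≈-refl
    cancel : ∀ D Y → subP (subP (mulP D Y) oneP) (mulP D (subP Y oneP)) ≈ subP D oneP
    cancel = solve 2 (λ D Y → (D :* Y :- con (+ 1)) :- D :* (Y :- con (+ 1)) := D :- con (+ 1)) ≈-refl

  gcd-combination : ∀ a b → Combination a b (gcd a b)
  gcd-combination a b with Bézout.identity (gcd-GCD a b)
  ... | Bézout.+- x y eq = combination-of-identity {gcd a b} {a} {b} x y eq
  ... | Bézout.-+ x y eq = combination-sym {b} {a} {gcd a b} (combination-of-identity {gcd a b} {b} {a} y x eq)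

module TotientSum where

  open import Defs
  open import Data.Nat as ℕ using (ℕ; zero; suc; z≤n; s≤s; _≤_; _+_; _*_; _≟_)
  import Data.Nat.Properties as ℕP
  open import Data.Nat.Divisibility as ND using (_∣_; divides; _∣?_)
  open import Data.Nat.GCD using (gcd; gcd[m,n]∣m; gcd[m,n]∣n; c*gcd[m,n]≡gcd[cm,cn])
  open import Data.Nat.ListAction using (sum)
  open import Data.Nat.Solver using (module +-*-Solver)
  open import Data.List using (List; []; _∷_; map; length; _++_; filter; applyUpTo)
  open import Data.List.Properties using (map-++; applyUpTo-∷ʳ; ++-identityʳ; ++-assoc; filter-++; filter-none; filter-≐; length-++; length-applyUpTo)
  open import Data.List.Membership.Propositional using (_∈_)
  open import Data.List.Membership.Propositional.Properties using (∈-filter⁻; ∈-applyUpTo⁻; ∈-map⁻)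
  open import Data.List.Relation.Unary.Any using (here; there)
  import Data.List.Relation.Unary.All as All
  open import Data.Product using (_×_; _,_; proj₂)
  open import Data.Empty using (⊥-elim)
  open import Relation.Nullary using (¬_; yes; no; Dec)
  open import Relation.Unary using (Pred; Decidable)
  open import Relation.Binary.PropositionalEquality
  open import Level using (0ℓ)

  upto : ℕ → List ℕ
  upto n = applyUpTo suc n

  divisorsUpTo : ℕ → ℕ → List ℕ
  divisorsUpTo d m = filter (_∣? d) (upto m)

  divisors : ℕ → List ℕ
  divisors d = divisorsUpTo d d

  indicator : ∀ {P : Set} → Dec P → ℕ
  indicator (yes _) = 1
  indicator (no _) = 0

  module _ {P : Pred ℕ 0ℓ} (P? : Decidable P) where

    count-∷ : ∀ x xs → length (filter P? (x ∷ xs)) ≡ indicator (P? x) + length (filter P? xs)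
    count-∷ x xs with P? x
    ... | yes _ = refl
    ... | no _ = refl

    count-++ : ∀ xs ys → length (filter P? (xs ++ ys)) ≡ length (filter P? xs) + length (filter P? ys)
    count-++ xs ys = trans (cong length (filter-++ P? xs ys)) (length-++ (filter P? xs))

    count-none : ∀ xs → (∀ {x} → x ∈ xs → ¬ P x) → length (filter P? xs) ≡ 0
    count-none xs none = cong length (filter-none P? (All.tabulate none))

    indicator-no : ∀ {x} → ¬ P x → indicator (P? x) ≡ 0
    indicator-no {x} ¬px with P? x
    ... | yes px = ⊥-elim (¬px px)
    ... | no _ = refl

  upto-suc : ∀ n → upto (suc n) ≡ upto n ++ (suc n ∷ [])
  upto-suc n = sym (applyUpTo-∷ʳ suc n)

  upto-+ : ∀ m n → upto (m + n) ≡ upto m ++ map (m +_) (upto n)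
  upto-+ m zero = trans (cong upto (ℕP.+-identityʳ m)) (sym (++-identityʳ (upto m)))
  upto-+ m (suc n) =
    begin
      upto (m + suc n)
    ≡⟨ cong upto (ℕP.+-suc m n) ⟩
      upto (suc (m + n))
    ≡⟨ upto-suc (m + n) ⟩
      upto (m + n) ++ (suc (m + n) ∷ [])
    ≡⟨ cong (_++ (suc (m + n) ∷ [])) (upto-+ m n) ⟩
      (upto m ++ map (m +_) (upto n)) ++ (suc (m + n) ∷ [])
    ≡⟨ ++-assoc (upto m) (map (m +_) (upto n)) (suc (m + n) ∷ []) ⟩
      upto m ++ (map (m +_) (upto n) ++ (suc (m + n) ∷ []))
    ≡⟨ cong (λ z → upto m ++ (map (m +_) (upto n) ++ (z ∷ []))) (ℕP.+-suc m n) ⟨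
      upto m ++ (map (m +_) (upto n) ++ map (m +_) (suc n ∷ []))
    ≡⟨ cong (upto m ++_) (trans (cong (map (m +_)) (upto-suc n)) (map-++ (m +_) (upto n) (suc n ∷ []))) ⟨
      upto m ++ map (m +_) (upto (suc n))
    ∎
    where open ≡-Reasoning

  ∈-upto : ∀ {x n} → x ∈ upto n → 1 ≤ x × x ≤ n
  ∈-upto {x} {n} x∈ with ∈-applyUpTo⁻ suc {n = n} x∈
  ... | i , i<n , refl = s≤s z≤n , i<n

  module Multiples (g′ : ℕ) {P : Pred ℕ 0ℓ} (P? : Decidable P) (P⇒g∣ : ∀ {k} → P k → suc g′ ∣ k) where
    g = suc g′

    P∘g*? : Decidable (λ j → P (g * j))
    P∘g*? j = P? (g * j)

    count-block : ∀ e → length (filter P? (map (e * g +_) (upto g))) ≡ indicator (P? (g * suc e))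
    count-block e =
      begin
        length (filter P? (map (e * g +_) (upto g)))
      ≡⟨ cong (λ z → length (filter P? z)) (trans (cong (map (e * g +_)) (upto-suc g′)) (map-++ (e * g +_) (upto g′) (g ∷ []))) ⟩
        length (filter P? (map (e * g +_) (upto g′) ++ (e * g + g ∷ [])))
      ≡⟨ count-++ P? (map (e * g +_) (upto g′)) (e * g + g ∷ []) ⟩
        length (filter P? (map (e * g +_) (upto g′))) + length (filter P? (e * g + g ∷ []))
      ≡⟨ cong₂ _+_ (count-none P? (map (e * g +_) (upto g′)) not-multiple) (count-∷ P? (e * g + g) []) ⟩
        indicator (P? (e * g + g)) + 0
      ≡⟨ ℕP.+-identityʳ _ ⟩
        indicator (P? (e * g + g))
      ≡⟨ cong (λ k → indicator (P? k)) (solve 2 (λ e g → e :* g :+ g := g :* (con 1 :+ e)) refl e g) ⟩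
        indicator (P? (g * suc e))
      ∎
      where
      open ≡-Reasoning
      open +-*-Solver
      not-multiple : ∀ {x} → x ∈ map (e * g +_) (upto g′) → ¬ P x
      not-multiple x∈ px with ∈-map⁻ (e * g +_) x∈
      ... | i , i∈ , refl with ∈-upto {i} {g′} i∈ | ND.∣m+n∣m⇒∣n (P⇒g∣ px) (ND.n∣m*n e)
      ... | 1≤i , i≤g′ | g∣i = ℕP.<⇒≱ (s≤s i≤g′) (ND.∣⇒≤ {{ℕ.>-nonZero 1≤i}} g∣i)

    count-multiples : ∀ e → length (filter P? (upto (e * g))) ≡ length (filter P∘g*? (upto e))
    count-multiples zero = refl
    count-multiples (suc e) =
      begin
        length (filter P? (upto (g + e * g)))
      ≡⟨ cong (λ z → length (filter P? z)) (trans (cong upto (ℕP.+-comm g (e * g))) (upto-+ (e * g) g)) ⟩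
        length (filter P? (upto (e * g) ++ map (e * g +_) (upto g)))
      ≡⟨ count-++ P? (upto (e * g)) (map (e * g +_) (upto g)) ⟩
        length (filter P? (upto (e * g))) + length (filter P? (map (e * g +_) (upto g)))
      ≡⟨ cong₂ _+_ (count-multiples e) (trans (count-block e) (sym (ℕP.+-identityʳ _))) ⟩
        length (filter P∘g*? (upto e)) + (indicator (P∘g*? (suc e)) + 0)
      ≡⟨ cong (length (filter P∘g*? (upto e)) +_) (count-∷ P∘g*? (suc e) []) ⟨
        length (filter P∘g*? (upto e)) + length (filter P∘g*? (suc e ∷ []))
      ≡⟨ trans (cong (λ z → length (filter P∘g*? z)) (upto-suc e)) (count-++ P∘g*? (upto e) (suc e ∷ [])) ⟨
        length (filter P∘g*? (upto (suc e)))
      ∎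
      where open ≡-Reasoning

  sum-map-+ : ∀ (A B : ℕ → ℕ) ts → sum (map (λ t → A t + B t) ts) ≡ sum (map A ts) + sum (map B ts)
  sum-map-+ A B [] = refl
  sum-map-+ A B (t ∷ ts) =
    trans (cong (A t + B t +_) (sum-map-+ A B ts))
      (solve 4 (λ a b x y → a :+ b :+ (x :+ y) := a :+ x :+ (b :+ y)) refl (A t) (B t) (sum (map A ts)) (sum (map B ts)))
    where open +-*-Solver

  sum-map-cong : ∀ (A B : ℕ → ℕ) ts → (∀ {t} → t ∈ ts → A t ≡ B t) → sum (map A ts) ≡ sum (map B ts)
  sum-map-cong A B [] eq = refl
  sum-map-cong A B (t ∷ ts) eq = cong₂ _+_ (eq (here refl)) (sum-map-cong A B ts (λ t∈ → eq (there t∈)))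

  sum-indicator : ∀ {P : Pred ℕ 0ℓ} (P? : Decidable P) ts → sum (map (λ t → indicator (P? t)) ts) ≡ length (filter P? ts)
  sum-indicator P? [] = refl
  sum-indicator P? (t ∷ ts) = trans (cong (indicator (P? t) +_) (sum-indicator P? ts)) (sym (count-∷ P? t ts))

  occurrences : ℕ → List ℕ → ℕ
  occurrences v ts = length (filter (v ≟_) ts)

  fibre : (ℕ → ℕ) → List ℕ → ℕ → ℕ
  fibre f xs t = length (filter (λ x → f x ≟ t) xs)

  length≡sum-fibres : ∀ (f : ℕ → ℕ) xs ts → (∀ {x} → x ∈ xs → occurrences (f x) ts ≡ 1) →
                      length xs ≡ sum (map (fibre f xs) ts)
  length≡sum-fibres f [] ts once = sym (zeros ts)
    where
    zeros : ∀ ts → sum (map (fibre f []) ts) ≡ 0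
    zeros [] = refl
    zeros (_ ∷ ts) = zeros ts
  length≡sum-fibres f (x ∷ xs) ts once =
    begin
      suc (length xs)
    ≡⟨ cong suc (length≡sum-fibres f xs ts (λ x∈ → once (there x∈))) ⟩
      suc (sum (map (fibre f xs) ts))
    ≡⟨ cong (_+ sum (map (fibre f xs) ts)) (trans (sum-indicator (f x ≟_) ts) (once (here refl))) ⟨
      sum (map (λ t → indicator (f x ≟ t)) ts) + sum (map (fibre f xs) ts)
    ≡⟨ sum-map-+ (λ t → indicator (f x ≟ t)) (fibre f xs) ts ⟨
      sum (map (λ t → indicator (f x ≟ t) + fibre f xs t) ts)
    ≡⟨ sum-map-cong (fibre f (x ∷ xs)) (λ t → indicator (f x ≟ t) + fibre f xs t) ts (λ {t} _ → count-∷ (λ y → f y ≟ t) x xs) ⟨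
      sum (map (fibre f (x ∷ xs)) ts)
    ∎
    where open ≡-Reasoning

  occurrences-filter : ∀ {P : Pred ℕ 0ℓ} (P? : Decidable P) v ts → P v → occurrences v (filter P? ts) ≡ occurrences v ts
  occurrences-filter P? v [] pv = refl
  occurrences-filter P? v (t ∷ ts) pv with P? t
  ... | yes _ = trans (count-∷ (v ≟_) t (filter P? ts)) (trans (cong (indicator (v ≟ t) +_) (occurrences-filter P? v ts pv)) (sym (count-∷ (v ≟_) t ts)))
  ... | no ¬pt = trans (occurrences-filter P? v ts pv)
                   (sym (trans (count-∷ (v ≟_) t ts) (cong (_+ occurrences v ts) (indicator-no (v ≟_) λ { refl → ¬pt pv }))))

  occurrences-upto : ∀ v m → 1 ≤ v → v ≤ m → occurrences v (upto m) ≡ 1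
  occurrences-upto .zero zero () z≤n
  occurrences-upto v (suc m) 1≤v v≤1+m =
    begin
      occurrences v (upto (suc m))
    ≡⟨ trans (cong (occurrences v) (upto-suc m)) (count-++ (v ≟_) (upto m) (suc m ∷ [])) ⟩
      occurrences v (upto m) + occurrences v (suc m ∷ [])
    ≡⟨ cong (occurrences v (upto m) +_) (count-∷ (v ≟_) (suc m) []) ⟩
      occurrences v (upto m) + (indicator (v ≟ suc m) + 0)
    ≡⟨ last-or-earlier (v ≟ suc m) ⟩
      1
    ∎
    where
    open ≡-Reasoning
    last-or-earlier : (v≟ : Dec (v ≡ suc m)) → occurrences v (upto m) + (indicator v≟ + 0) ≡ 1
    last-or-earlier (yes refl) = cong (_+ 1) (count-none (suc m ≟_) (upto m) λ x∈ eq → ℕP.<-irrefl refl (subst (_≤ m) (sym eq) (proj₂ (∈-upto x∈))))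
    last-or-earlier (no v≢) = trans (ℕP.+-identityʳ _) (occurrences-upto v m 1≤v (ℕP.≤-pred (ℕP.≤∧≢⇒< v≤1+m v≢)))

  -- The additive order of k in ℤ/d, i.e. d / gcd(k, d).
  order : ℕ → ℕ → ℕ
  order d k = ND._∣_.quotient (gcd[m,n]∣n k d)

  order-spec : ∀ d k → d ≡ order d k * gcd k d
  order-spec d k = ND._∣_.equality (gcd[m,n]∣n k d)

  -- The k ∈ [1, d] of order e are the g j with g = d / e and j ∈ [1, e] coprime to e.
  count-order : ∀ d e → e ∣ d → 1 ≤ d → length (filter (λ k → order d k ≟ e) (upto d)) ≡ totient e
  count-order .(zero * e) e (divides zero refl) ()
  count-order .(suc g′ * zero) zero (divides (suc g′) refl) 1≤d = ⊥-elim (ℕP.<⇒≱ 1≤d (ℕP.≤-reflexive (ℕP.*-zeroʳ g′)))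
  count-order d (suc e′) (divides (suc g′) d≡g*e) 1≤d =
    begin
      length (filter (λ k → order d k ≟ e) (upto d))
    ≡⟨ cong length (filter-≐ (λ k → order d k ≟ e) (λ k → gcd k d ≟ g) ((λ {k} → order≡e⇒gcd≡g {k}) , (λ {k} → gcd≡g⇒order≡e {k})) (upto d)) ⟩
      length (filter (λ k → gcd k d ≟ g) (upto d))
    ≡⟨ cong (λ z → length (filter (λ k → gcd k d ≟ g) (upto z))) d≡e*g ⟩
      length (filter (λ k → gcd k d ≟ g) (upto (e * g)))
    ≡⟨ Multiples.count-multiples g′ (λ k → gcd k d ≟ g) (λ {k} eq → subst (_∣ k) eq (gcd[m,n]∣m k d)) e ⟩
      length (filter (λ j → gcd (g * j) d ≟ g) (upto e))
    ≡⟨ cong length (filter-≐ (λ j → gcd (g * j) d ≟ g) (λ j → gcd j e ≟ 1) ((λ {j} → gcd≡g⇒coprime {j}) , (λ {j} → coprime⇒gcd≡g {j})) (upto e)) ⟩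
      totient e
    ∎
    where
    open ≡-Reasoning
    g = suc g′
    e = suc e′
    d≡e*g : d ≡ e * g
    d≡e*g = trans d≡g*e (ℕP.*-comm g e)
    order≡e⇒gcd≡g : ∀ {k} → order d k ≡ e → gcd k d ≡ g
    order≡e⇒gcd≡g {k} eq = ℕP.*-cancelˡ-≡ (gcd k d) g e (trans (sym (trans (order-spec d k) (cong (_* gcd k d) eq))) d≡e*g)
    gcd≡g⇒order≡e : ∀ {k} → gcd k d ≡ g → order d k ≡ e
    gcd≡g⇒order≡e {k} eq = ℕP.*-cancelʳ-≡ (order d k) e g (trans (sym (trans (order-spec d k) (cong (order d k *_) eq))) d≡e*g)
    gcd-g* : ∀ j → gcd (g * j) d ≡ g * gcd j e
    gcd-g* j = trans (cong (gcd (g * j)) d≡g*e) (sym (c*gcd[m,n]≡gcd[cm,cn] g j e))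
    gcd≡g⇒coprime : ∀ {j} → gcd (g * j) d ≡ g → gcd j e ≡ 1
    gcd≡g⇒coprime {j} eq = ℕP.*-cancelˡ-≡ (gcd j e) 1 g (trans (sym (gcd-g* j)) (trans eq (sym (ℕP.*-identityʳ g))))
    coprime⇒gcd≡g : ∀ {j} → gcd j e ≡ 1 → gcd (g * j) d ≡ g
    coprime⇒gcd≡g {j} eq = trans (gcd-g* j) (trans (cong (g *_) eq) (ℕP.*-identityʳ g))

  -- Sorting [1, d] by additive order.
  sum-totient-divisors : ∀ d → 1 ≤ d → sum (map totient (divisors d)) ≡ d
  sum-totient-divisors d 1≤d =
    begin
      sum (map totient (divisors d))
    ≡⟨ sum-map-cong (fibre (order d) (upto d)) totient (divisors d)
         (λ {e} e∈ → count-order d e (proj₂ (∈-filter⁻ (_∣? d) {xs = upto d} e∈)) 1≤d) ⟨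
      sum (map (fibre (order d) (upto d)) (divisors d))
    ≡⟨ length≡sum-fibres (order d) (upto d) (divisors d) order-once ⟨
      length (upto d)
    ≡⟨ length-applyUpTo suc d ⟩
      d
    ∎
    where
    open ≡-Reasoning
    order-once : ∀ {k} → k ∈ upto d → occurrences (order d k) (divisors d) ≡ 1
    order-once {k} _ = trans (occurrences-filter (_∣? d) (order d k) (upto d) order∣d) (occurrences-upto (order d k) d 1≤order order≤d)
      where
      order∣d : order d k ∣ d
      order∣d = divides (gcd k d) (trans (order-spec d k) (ℕP.*-comm (order d k) (gcd k d)))
      1≤order : 1 ≤ order d k
      1≤order with order d k | order-spec d k
      ... | zero | eq = ⊥-elim (ℕP.<⇒≱ 1≤d (ℕP.≤-reflexive eq))
      ... | suc _ | _ = s≤s z≤n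
      order≤d : order d k ≤ d
      order≤d = ND.∣⇒≤ {{ℕ.>-nonZero 1≤d}} order∣d

module Cyclotomic where

  open import Defs
  open Polynomial
  open MonicDivision
  open Divisibility
  open TotientSum
  open import Data.Nat as ℕ using (ℕ; zero; suc; _∸_; z≤n; s≤s; _≤_; _<_)
  import Data.Nat.Properties as ℕP
  open import Data.Nat.Divisibility as ND using (_∣_; divides; _∣?_)
  open import Data.Nat.GCD using (gcd; gcd[m,n]∣m; gcd[m,n]∣n)
  open import Data.Nat.ListAction using (sum)
  open import Data.Nat.ListAction.Properties using (sum-++)
  open import Data.Nat.Induction using (<-rec)
  open import Data.Nat.Primality using (Prime; prime⇒irreducible; ¬prime[0]; ¬prime[1])
  open import Data.Integer using (+_)
  open import Data.List using (List; []; _∷_; map; length; _++_; filter)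
  open import Data.List.Properties using (map-++; applyUpTo-∷ʳ; ++-identityʳ; filter-++; filter-accept; filter-reject)
  open import Data.List.Membership.Propositional using (_∈_)
  open import Data.List.Membership.Propositional.Properties using (∈-filter⁻)
  open import Data.List.Relation.Unary.Any using (here; there)
  open import Data.Product using (Σ; _×_; _,_; proj₁; proj₂)
  open import Data.Sum using (inj₁; inj₂)
  open import Data.Empty using (⊥-elim)
  open import Relation.Nullary using (¬_; yes; no; does; ¬?)
  open import Data.Bool using (true; false)
  open import Relation.Binary.PropositionalEquality
  open Solver using (solve; _:+_; _:*_; _:-_; :-_; _:=_)

  ∏Φ : List ℕ → Poly
  ∏Φ ds = prodP (map Φ ds)

  ∏Φ-++ : ∀ xs ys → ∏Φ (xs ++ ys) ≈ mulP (∏Φ xs) (∏Φ ys)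
  ∏Φ-++ [] ys = ≈-sym (mul-identityˡ (∏Φ ys))
  ∏Φ-++ (x ∷ xs) ys = ≈-trans (mul-congʳ (Φ x) (∏Φ-++ xs ys)) (≈-sym (mul-assoc (Φ x) (∏Φ xs) (∏Φ ys)))

  ∏Φ-[_] : ∀ x → ∏Φ (x ∷ []) ≈ Φ x
  ∏Φ-[ x ] = ≈-trans (mul-comm (Φ x) oneP) (mul-identityˡ (Φ x))

  ∏Φ-partition : ∀ g ds → ∏Φ ds ≈ mulP (∏Φ (filter (_∣? g) ds)) (∏Φ (filter (λ x → ¬? (x ∣? g)) ds))
  ∏Φ-partition g [] = ≈-sym (mul-identityˡ oneP)
  ∏Φ-partition g (x ∷ ds) with x ∣? g
  ... | yes _ = ≈-trans (mul-congʳ (Φ x) (∏Φ-partition g ds)) (≈-sym (mul-assoc (Φ x) _ _))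
  ... | no _ = ≈-trans (mul-congʳ (Φ x) (∏Φ-partition g ds)) (swap (Φ x) (∏Φ (filter (_∣? g) ds)) (∏Φ (filter (λ x → ¬? (x ∣? g)) ds)))
    where
    swap : ∀ a b c → mulP a (mulP b c) ≈ mulP b (mulP a c)
    swap = solve 3 (λ a b c → a :* (b :* c) := b :* (a :* c)) ≈-refl

  degΦ : ℕ → ℕ
  degΦ e = ℕ.pred (length (Φ e))

  monic-∏Φ : ∀ ds → (∀ {e} → e ∈ ds → Monic (degΦ e) (Φ e)) → Monic (sum (map degΦ ds)) (∏Φ ds)
  monic-∏Φ [] monic = monic-one
  monic-∏Φ (e ∷ ds) monic = monic-mul (monic (here refl)) (monic-∏Φ ds (λ e∈ → monic (there e∈)))

  coprime-∏Φ : ∀ x ds → (∀ {e} → e ∈ ds → Coprime (Φ x) (Φ e)) → Coprime (Φ x) (∏Φ ds)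
  coprime-∏Φ x [] coprime = coprime-oneʳ (Φ x)
  coprime-∏Φ x (e ∷ ds) coprime = coprime-*ʳ (coprime (here refl)) (coprime-∏Φ x ds (λ e∈ → coprime (there e∈)))

  private
    pairs : List ℕ → List (ℕ × Poly)
    pairs = map (λ k → (k , Φ k))

    cycloTable≡pairs : ∀ n → cycloTable n ≡ pairs (upto n)
    cycloTable≡pairs zero = refl
    cycloTable≡pairs (suc n) =
      trans (cong (_++ ((suc n , Φ (suc n)) ∷ [])) (cycloTable≡pairs n))
        (trans (sym (map-++ (λ k → (k , Φ k)) (upto n) (suc n ∷ []))) (cong pairs (applyUpTo-∷ʳ suc n)))

    filter-pairs : ∀ e ks → filter (λ p → proj₁ p ∣? e) (pairs ks) ≡ pairs (filter (_∣? e) ks)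
    filter-pairs e [] = refl
    filter-pairs e (k ∷ ks) with does (k ∣? e)
    ... | true = cong ((k , Φ k) ∷_) (filter-pairs e ks)
    ... | false = filter-pairs e ks

    map-proj₂-pairs : ∀ ks → map proj₂ (pairs ks) ≡ map Φ ks
    map-proj₂-pairs [] = refl
    map-proj₂-pairs (k ∷ ks) = cong (Φ k ∷_) (map-proj₂-pairs ks)

  Φ≡longQuotient : ∀ d′ → Φ (suc d′) ≡ longQuotient (xpm1 (suc d′)) (∏Φ (divisorsUpTo (suc d′) d′))
  Φ≡longQuotient d′ =
    begin
      quotMonic (xpm1 d) (prodP (map proj₂ (filter (λ p → proj₁ p ∣? d) (cycloTable d′))))
    ≡⟨ cong (λ T → quotMonic (xpm1 d) (prodP (map proj₂ (filter (λ p → proj₁ p ∣? d) T)))) (cycloTable≡pairs d′) ⟩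
      quotMonic (xpm1 d) (prodP (map proj₂ (filter (λ p → proj₁ p ∣? d) (pairs (upto d′)))))
    ≡⟨ cong (λ T → quotMonic (xpm1 d) (prodP (map proj₂ T))) (filter-pairs d (upto d′)) ⟩
      quotMonic (xpm1 d) (prodP (map proj₂ (pairs (divisorsUpTo d d′))))
    ≡⟨ cong (λ T → quotMonic (xpm1 d) (prodP T)) (map-proj₂-pairs (divisorsUpTo d d′)) ⟩
      quotMonic (xpm1 d) (∏Φ (divisorsUpTo d d′))
    ≡⟨ quotMonic≡longQuotient (xpm1 d) (∏Φ (divisorsUpTo d d′)) ⟩
      longQuotient (xpm1 d) (∏Φ (divisorsUpTo d d′))
    ∎
    where
    open ≡-Reasoning
    d = suc d′

  divisorsUpTo-suc : ∀ d m → divisorsUpTo d (suc m) ≡ divisorsUpTo d m ++ filter (_∣? d) (suc m ∷ [])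
  divisorsUpTo-suc d m = trans (cong (filter (_∣? d)) (upto-suc m)) (filter-++ (_∣? d) (upto m) (suc m ∷ []))

  divisorsUpTo-∣ : ∀ {d m} → suc m ∣ d → divisorsUpTo d (suc m) ≡ divisorsUpTo d m ++ (suc m ∷ [])
  divisorsUpTo-∣ {d} {m} m∣d = trans (divisorsUpTo-suc d m) (cong (divisorsUpTo d m ++_) (filter-accept (_∣? d) m∣d))

  divisorsUpTo-∤ : ∀ {d m} → ¬ (suc m ∣ d) → divisorsUpTo d (suc m) ≡ divisorsUpTo d m
  divisorsUpTo-∤ {d} {m} m∤d = trans (divisorsUpTo-suc d m) (trans (cong (divisorsUpTo d m ++_) (filter-reject (_∣? d) m∤d)) (++-identityʳ _))

  ∈-divisorsUpTo : ∀ {e} d m → e ∈ divisorsUpTo d m → 1 ≤ e × e ≤ m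
  ∈-divisorsUpTo d m e∈ = ∈-upto (proj₁ (∈-filter⁻ (_∣? d) {xs = upto m} e∈))

  filter-∣?-filter-∣? : ∀ {g e} ks → (∀ {x} → x ∣ g → x ∣ e) → filter (_∣? g) (filter (_∣? e) ks) ≡ filter (_∣? g) ks
  filter-∣?-filter-∣? [] g⇒e = refl
  filter-∣?-filter-∣? {g} {e} (x ∷ ks) g⇒e with x ∣? g in eq
  ... | yes x∣g with x ∣? e
  ...   | yes _ rewrite eq = cong (x ∷_) (filter-∣?-filter-∣? ks g⇒e)
  ...   | no x∤e = ⊥-elim (x∤e (g⇒e x∣g))
  filter-∣?-filter-∣? {g} {e} (x ∷ ks) g⇒e | no _ with x ∣? e
  ...   | yes _ rewrite eq = filter-∣?-filter-∣? ks g⇒e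
  ...   | no _ = filter-∣?-filter-∣? ks g⇒e

  divisorsUpTo-+ : ∀ g′ t → divisorsUpTo (suc g′) (t ℕ.+ suc g′) ≡ divisors (suc g′)
  divisorsUpTo-+ g′ zero = refl
  divisorsUpTo-+ g′ (suc t) =
    trans (divisorsUpTo-∤ {suc g′} {t ℕ.+ suc g′} (λ big∣g → ℕP.<⇒≱ (s≤s (ℕP.m≤n+m (suc g′) t)) (ND.∣⇒≤ big∣g)))
          (divisorsUpTo-+ g′ t)

  ∏Φ-divisors-split : ∀ {g e m} → suc g ∣ e → suc g ≤ m →
    ∏Φ (divisorsUpTo e m) ≈ mulP (∏Φ (divisors (suc g))) (∏Φ (filter (λ x → ¬? (x ∣? suc g)) (divisorsUpTo e m)))
  ∏Φ-divisors-split {g} {e} {m} g∣e g≤m =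
    ≈-trans (∏Φ-partition (suc g) (divisorsUpTo e m))
      (mul-congˡ (∏Φ (filter (λ x → ¬? (x ∣? suc g)) (divisorsUpTo e m))) (≡⇒≈ (cong ∏Φ (trans (filter-∣?-filter-∣? (upto m) (λ x∣g → ND.∣-trans x∣g g∣e))
                                        (trans (cong (divisorsUpTo (suc g)) (sym (ℕP.m∸n+n≡m g≤m))) (divisorsUpTo-+ g (m ∸ suc g)))))))

  Φ-Spec : ℕ → Set
  Φ-Spec d = Monic (degΦ d) (Φ d) × ∏Φ (divisors d) ≈ xpm1 d

  xpm1≈∏Φ*Φ : ∀ d′ → Φ-Spec (suc d′) → xpm1 (suc d′) ≈ mulP (∏Φ (divisorsUpTo (suc d′) d′)) (Φ (suc d′))
  xpm1≈∏Φ*Φ d′ (_ , ∏≈) =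
    ≈-trans (≈-sym ∏≈)
     (≈-trans (≡⇒≈ (cong ∏Φ (divisorsUpTo-∣ {suc d′} {d′} ND.∣-refl)))
      (≈-trans (∏Φ-++ (divisorsUpTo (suc d′) d′) (suc d′ ∷ [])) (mul-congʳ (∏Φ (divisorsUpTo (suc d′) d′)) ∏Φ-[ suc d′ ])))

  Φ-spec⇒Φ∣xpm1 : ∀ d′ → Φ-Spec (suc d′) → Φ (suc d′) ∣≈ xpm1 (suc d′)
  Φ-spec⇒Φ∣xpm1 d′ spec = ∏Φ (divisorsUpTo (suc d′) d′) , ≈-trans (mul-comm (Φ (suc d′)) (∏Φ (divisorsUpTo (suc d′) d′))) (≈-sym (xpm1≈∏Φ*Φ d′ spec))

  xpm1-∣-xpm1 : ∀ {a d} → a ∣ d → xpm1 a ∣≈ xpm1 d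
  xpm1-∣-xpm1 {a} (divides k refl) = xpm1-∣-xpm1-* a k

  xpm1-factor : ∀ e′ g′ → Φ-Spec (suc e′) → Φ-Spec (suc g′) → suc g′ ∣ suc e′ → suc g′ ≤ e′ →
                Σ Poly (λ S → xpm1 (suc e′) ≈ mulP (xpm1 (suc g′)) (mulP S (Φ (suc e′))))
  xpm1-factor e′ g′ spec-e spec-g g∣e g≤e′ = S ,
    ≈-trans (xpm1≈∏Φ*Φ e′ spec-e)
     (≈-trans (mul-congˡ (Φ (suc e′)) (∏Φ-divisors-split g∣e g≤e′))
      (≈-trans (mul-congˡ (Φ (suc e′)) (mul-congˡ S (proj₂ spec-g)))
        (mul-assoc (xpm1 (suc g′)) S (Φ (suc e′)))))
    where
    S = ∏Φ (filter (λ x → ¬? (x ∣? suc g′)) (divisorsUpTo (suc e′) e′))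

  -- With e′ = k e, the cofactor G of x^e - 1 in x^e′ - 1 is S Φ e′ and is k modulo x^e - 1, a multiple of Φ e.
  coprime-Φ-∣ : ∀ e₀ e₁ → Φ-Spec (suc e₀) → Φ-Spec (suc e₁) → suc e₀ ∣ suc e₁ → suc e₀ ≤ e₁ → Coprime (Φ (suc e₀)) (Φ (suc e₁))
  coprime-Φ-∣ e₀ e₁ spec-e spec-e′ (divides zero ())
  coprime-Φ-∣ e₀ e₁ spec-e spec-e′ e∣e′@(divides (suc k) e′≡) e≤e₁ =
    negP (mulP R W) , S , + suc k , (λ ()) , bezout
    where
    e = suc e₀
    e′ = suc e₁
    factor = xpm1-factor e₁ e₀ spec-e′ spec-e e∣e′ e≤e₁
    S = proj₁ factor
    R = ∏Φ (divisorsUpTo e e₀)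
    W = geometricSums e (suc k)
    G = geometric e (suc k)
    xpm1*G : mulP (xpm1 e) G ≈ mulP (xpm1 e) (mulP S (Φ e′))
    xpm1*G = ≈-trans (mul-congˡ G (xpm1≈X^-1 e))
              (≈-trans (≈-sym (geometric-spec e (suc k)))
               (≈-trans (≈-sym (xpm1≈X^-1 (suc k ℕ.* e)))
                (≈-trans (≡⇒≈ (cong xpm1 (sym e′≡))) (proj₂ factor))))
    G≈SΦ : G ≈ mulP S (Φ e′)
    G≈SΦ = monic-cancelˡ (monic-xpm1 e₀) G (mulP S (Φ e′)) xpm1*G
    rearrange : ∀ R W Φe S Φe′ → addP (mulP (negP (mulP R W)) Φe) (mulP S Φe′) ≈ subP (mulP S Φe′) (mulP (mulP R Φe) W)
    rearrange = solve 5 (λ R W Φe S Φe′ → (:- (R :* W)) :* Φe :+ S :* Φe′ := S :* Φe′ :- (R :* Φe) :* W) ≈-refl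
    cancel : ∀ G K → subP G (subP G K) ≈ K
    cancel = solve 2 (λ G K → G :- (G :- K) := K) ≈-refl
    bezout : addP (mulP (negP (mulP R W)) (Φ e)) (mulP S (Φ e′)) ≈ const (+ suc k)
    bezout = ≈-trans (rearrange R W (Φ e) S (Φ e′))
              (≈-trans (sub-cong (≈-sym G≈SΦ) (mul-congˡ W (≈-trans (≈-sym (xpm1≈∏Φ*Φ e₀ spec-e)) (xpm1≈X^-1 e))))
               (≈-trans (sub-cong (≈-refl {G}) (≈-sym (geometricSums-spec e (suc k)))) (cancel G (const (+ suc k)))))

  -- Divide u (x^e - 1) + v (x^e′ - 1) = x^g - 1 by x^g - 1, a factor of both x^e - 1 and x^e′ - 1.
  coprime-Φ-gcd : ∀ e₀ e₁ g₀ → Φ-Spec (suc e₀) → Φ-Spec (suc e₁) → Φ-Spec (suc g₀) → suc g₀ ∣ suc e₀ → suc g₀ ∣ suc e₁ →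
                  suc g₀ ≤ e₀ → suc g₀ ≤ e₁ → Combination (suc e₀) (suc e₁) (suc g₀) → Coprime (Φ (suc e₀)) (Φ (suc e₁))
  coprime-Φ-gcd e₀ e₁ g₀ spec-e spec-e′ spec-g g∣e g∣e′ g≤e₀ g≤e₁ (u , v , comb) =
    mulP u S , mulP v S′ , + 1 , (λ ()) , monic-cancelˡ (monic-xpm1 g₀) L oneP xpm1*L
    where
    e = suc e₀
    e′ = suc e₁
    g = suc g₀
    factor = xpm1-factor e₀ g₀ spec-e spec-g g∣e g≤e₀
    factor′ = xpm1-factor e₁ g₀ spec-e′ spec-g g∣e′ g≤e₁
    S = proj₁ factor
    S′ = proj₁ factor′
    L = addP (mulP (mulP u S) (Φ e)) (mulP (mulP v S′) (Φ e′))
    distribute : ∀ x u v Se Φe Se′ Φe′ → mulP x (addP (mulP (mulP u Se) Φe) (mulP (mulP v Se′) Φe′))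
                                     ≈ addP (mulP u (mulP x (mulP Se Φe))) (mulP v (mulP x (mulP Se′ Φe′)))
    distribute = solve 7 (λ x u v Se Φe Se′ Φe′ → x :* ((u :* Se) :* Φe :+ (v :* Se′) :* Φe′) := u :* (x :* (Se :* Φe)) :+ v :* (x :* (Se′ :* Φe′))) ≈-refl
    xpm1*L : mulP (xpm1 g) L ≈ mulP (xpm1 g) oneP
    xpm1*L = ≈-trans (distribute (xpm1 g) u v S (Φ e) S′ (Φ e′))
              (≈-trans (add-cong (mul-congʳ u (≈-trans (≈-sym (proj₂ factor)) (xpm1≈X^-1 e))) (mul-congʳ v (≈-trans (≈-sym (proj₂ factor′)) (xpm1≈X^-1 e′))))
               (≈-trans comb (≈-trans (≈-sym (xpm1≈X^-1 g)) (≈-sym (≈-trans (mul-comm (xpm1 g) oneP) (mul-identityˡ (xpm1 g)))))))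

  ∣-≢⇒< : ∀ {g₀ e₀} → suc g₀ ∣ suc e₀ → suc g₀ ≢ suc e₀ → suc g₀ ≤ e₀
  ∣-≢⇒< g∣e g≢e = ℕP.≤-pred (ℕP.≤∧≢⇒< (ND.∣⇒≤ g∣e) g≢e)

  Φ-SpecBelow : ℕ → Set
  Φ-SpecBelow d = ∀ e → 1 ≤ e → e < d → Φ-Spec e

  module _ {d : ℕ} (IH : Φ-SpecBelow d) where

    coprime-Φ : ∀ e′ e₁′ → suc e′ < d → suc e₁′ < d → suc e′ ≢ suc e₁′ → Coprime (Φ (suc e′)) (Φ (suc e₁′))
    coprime-Φ e₀ e₁ e<d e′<d e≢e′ = by-gcd (gcd e e′) (gcd[m,n]∣m e e′) (gcd[m,n]∣n e e′) (gcd-combination e e′)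
      where
      e = suc e₀
      e′ = suc e₁
      spec-e = IH e (s≤s z≤n) e<d
      spec-e′ = IH e′ (s≤s z≤n) e′<d
      by-gcd : ∀ g → g ∣ e → g ∣ e′ → Combination e e′ g → Coprime (Φ e) (Φ e′)
      by-gcd zero 0∣e _ _ with () ← ND.0∣⇒≡0 0∣e
      by-gcd (suc g₀) g∣e g∣e′ comb with suc g₀ ℕP.≟ e | suc g₀ ℕP.≟ e′
      ... | yes refl | _ = coprime-Φ-∣ e₀ e₁ spec-e spec-e′ g∣e′ (∣-≢⇒< g∣e′ e≢e′)
      ... | no _ | yes refl = coprime-sym (coprime-Φ-∣ e₁ e₀ spec-e′ spec-e g∣e (∣-≢⇒< g∣e (λ eq → e≢e′ (sym eq))))
      ... | no g≢e | no g≢e′ =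
        coprime-Φ-gcd e₀ e₁ g₀ spec-e spec-e′ (IH (suc g₀) (s≤s z≤n) (ℕP.<-trans (s≤s (∣-≢⇒< g∣e g≢e)) e<d))
          g∣e g∣e′ (∣-≢⇒< g∣e g≢e) (∣-≢⇒< g∣e′ g≢e′) comb

  module _ {d′ : ℕ} (IH : Φ-SpecBelow (suc d′)) where
    private
      d = suc d′

      monic-Φ-divisorsUpTo : ∀ {m} → m ≤ d′ → ∀ {e} → e ∈ divisorsUpTo d m → Monic (degΦ e) (Φ e)
      monic-Φ-divisorsUpTo {m} m≤d′ e∈ = proj₁ (IH _ (proj₁ (∈-divisorsUpTo d m e∈)) (s≤s (ℕP.≤-trans (proj₂ (∈-divisorsUpTo d m e∈)) m≤d′)))

    -- The proper divisors are added one at a time; each new Φ is coprime to the product so far.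
    ∏Φ-divisorsUpTo-∣-xpm1 : ∀ m → m ≤ d′ → ∏Φ (divisorsUpTo d m) ∣≈ xpm1 d
    ∏Φ-divisorsUpTo-∣-xpm1 zero _ = xpm1 d , mul-identityˡ (xpm1 d)
    ∏Φ-divisorsUpTo-∣-xpm1 (suc m) m<d′ with suc m ∣? d
    ... | no m∤d = subst (λ ds → ∏Φ ds ∣≈ xpm1 d) (sym (divisorsUpTo-∤ m∤d)) (∏Φ-divisorsUpTo-∣-xpm1 m m≤d′)
      where m≤d′ = ℕP.≤-trans (ℕP.n≤1+n m) m<d′
    ... | yes m∣d =
      ∣≈-respˡ (≈-sym (≈-trans (≡⇒≈ (cong ∏Φ (divisorsUpTo-∣ m∣d))) (≈-trans (∏Φ-++ (divisorsUpTo d m) (suc m ∷ [])) (mul-congʳ (∏Φ (divisorsUpTo d m)) ∏Φ-[ suc m ]))))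
        (coprime-∣-∣⇒*-∣ (monic-∏Φ (divisorsUpTo d m) (monic-Φ-divisorsUpTo m≤d′)) (proj₁ spec-m)
          (∏Φ-divisorsUpTo-∣-xpm1 m m≤d′) (∣≈-trans {Φ (suc m)} (Φ-spec⇒Φ∣xpm1 m spec-m) (xpm1-∣-xpm1 m∣d))
          (coprime-sym (coprime-∏Φ (suc m) (divisorsUpTo d m) coprime-new)))
      where
      m≤d′ = ℕP.≤-trans (ℕP.n≤1+n m) m<d′
      spec-m = IH (suc m) (s≤s z≤n) (s≤s m<d′)
      coprime-new : ∀ {e} → e ∈ divisorsUpTo d m → Coprime (Φ (suc m)) (Φ e)
      coprime-new {zero} e∈ with () ← proj₁ (∈-divisorsUpTo d m e∈)
      coprime-new {suc e₀} e∈ = coprime-Φ IH m e₀ (s≤s m<d′) (s≤s (ℕP.≤-trans e≤m m≤d′)) (λ { refl → ℕP.<-irrefl refl e≤m })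
        where e≤m = proj₂ (∈-divisorsUpTo d m e∈)

    Φ-spec-step : Φ-Spec d
    Φ-spec-step = subst (λ z → Monic z (Φ d)) (cong ℕ.pred (sym (monic-length monic-Φ))) monic-Φ , ∏Φ-divisors≈xpm1
      where
      Q = ∏Φ (divisorsUpTo d d′)
      monic-Q : Monic (sum (map degΦ (divisorsUpTo d d′))) Q
      monic-Q = monic-∏Φ (divisorsUpTo d d′) (monic-Φ-divisorsUpTo ℕP.≤-refl)
      Q∣xpm1 = ∏Φ-divisorsUpTo-∣-xpm1 d′ ℕP.≤-refl
      monic-Φ : Monic (d ∸ sum (map degΦ (divisorsUpTo d d′))) (Φ d)
      monic-Φ = subst (Monic _) (sym (Φ≡longQuotient d′))
                  (longQuotient-monic (monic-xpm1 d′) monic-Q (monic-∣-monic⇒≤ monic-Q (proj₂ Q∣xpm1) (monic-xpm1 d′)))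
      ∏Φ-divisors≈xpm1 : ∏Φ (divisors d) ≈ xpm1 d
      ∏Φ-divisors≈xpm1 =
        ≈-trans (≡⇒≈ (cong ∏Φ (divisorsUpTo-∣ {d} {d′} ND.∣-refl)))
         (≈-trans (∏Φ-++ (divisorsUpTo d d′) (d ∷ []))
          (≈-trans (mul-congʳ Q (≈-trans ∏Φ-[ d ] (≡⇒≈ (Φ≡longQuotient d′))))
           (longQuotient-exact monic-Q (xpm1 d) (proj₁ Q∣xpm1) (proj₂ Q∣xpm1))))

  Φ-spec : ∀ d → 1 ≤ d → Φ-Spec d
  Φ-spec = <-rec (λ d → 1 ≤ d → Φ-Spec d) step
    where
    step : ∀ d → (∀ {e} → e < d → 1 ≤ e → Φ-Spec e) → 1 ≤ d → Φ-Spec d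
    step (suc d′) IH _ = Φ-spec-step (λ e 1≤e e<d → IH e<d 1≤e)

  Φ∣xpm1 : ∀ d′ → Φ (suc d′) ∣≈ xpm1 (suc d′)
  Φ∣xpm1 d′ = Φ-spec⇒Φ∣xpm1 d′ (Φ-spec (suc d′) (s≤s z≤n))

  sum-divisors-split : ∀ (f : ℕ → ℕ) d′ → sum (map f (divisors (suc d′))) ≡ sum (map f (divisorsUpTo (suc d′) d′)) ℕ.+ f (suc d′)
  sum-divisors-split f d′ =
    trans (cong (λ ds → sum (map f ds)) (divisorsUpTo-∣ {suc d′} {d′} ND.∣-refl))
      (trans (cong sum (map-++ f (divisorsUpTo (suc d′) d′) (suc d′ ∷ [])))
        (trans (sum-++ (map f (divisorsUpTo (suc d′) d′)) (f (suc d′) ∷ [])) (cong (sum (map f (divisorsUpTo (suc d′) d′)) ℕ.+_) (ℕP.+-identityʳ _))))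

  -- Both degΦ and totient sum to d over the divisors of d.
  degΦ≡totient : ∀ d → 1 ≤ d → degΦ d ≡ totient d
  degΦ≡totient = <-rec (λ d → 1 ≤ d → degΦ d ≡ totient d) step
    where
    step : ∀ d → (∀ {e} → e < d → 1 ≤ e → degΦ e ≡ totient e) → 1 ≤ d → degΦ d ≡ totient d
    step (suc d′) IH _ =
      ℕP.+-cancelˡ-≡ (sum (map degΦ (divisorsUpTo d d′))) (degΦ d) (totient d) (begin
        sum (map degΦ (divisorsUpTo d d′)) ℕ.+ degΦ d      ≡⟨ sum-divisors-split degΦ d′ ⟨
        sum (map degΦ (divisors d))                         ≡⟨ sum-degΦ ⟩
        d                                                   ≡⟨ sum-totient-divisors d (s≤s z≤n) ⟨
        sum (map totient (divisors d))                      ≡⟨ sum-divisors-split totient d′ ⟩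
        sum (map totient (divisorsUpTo d d′)) ℕ.+ totient d ≡⟨ cong (ℕ._+ totient d) (sum-map-cong degΦ totient (divisorsUpTo d d′) IH′) ⟨
        sum (map degΦ (divisorsUpTo d d′)) ℕ.+ totient d    ∎)
      where
      open ≡-Reasoning
      d = suc d′
      IH′ : ∀ {e} → e ∈ divisorsUpTo d d′ → degΦ e ≡ totient e
      IH′ e∈ = IH (s≤s (proj₂ (∈-divisorsUpTo d d′ e∈))) (proj₁ (∈-divisorsUpTo d d′ e∈))
      sum-degΦ : sum (map degΦ (divisors d)) ≡ d
      sum-degΦ = monic-≈⇒≡ (monic-∏Φ (divisors d) (λ e∈ → proj₁ (Φ-spec _ (proj₁ (∈-divisorsUpTo d d e∈))))) (monic-xpm1 d′) (proj₂ (Φ-spec d (s≤s z≤n)))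

  monic-Φ : ∀ d → 1 ≤ d → Monic (totient d) (Φ d)
  monic-Φ d 1≤d = subst (λ D → Monic D (Φ d)) (degΦ≡totient d 1≤d) (proj₁ (Φ-spec d 1≤d))

  divisorsUpTo-prime : ∀ p′ → Prime (suc p′) → ∀ m → 1 ≤ m → m ≤ p′ → divisorsUpTo (suc p′) m ≡ 1 ∷ []
  divisorsUpTo-prime p′ p-prime (suc zero) _ _ = filter-accept (_∣? suc p′) (ND.1∣ suc p′)
  divisorsUpTo-prime p′ p-prime (suc (suc m)) _ m<p′ =
    trans (divisorsUpTo-∤ m∤p) (divisorsUpTo-prime p′ p-prime (suc m) (s≤s z≤n) (ℕP.≤-trans (ℕP.n≤1+n (suc m)) m<p′))
    where
    m∤p : ¬ (suc (suc m) ∣ suc p′)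
    m∤p m∣p with prime⇒irreducible p-prime m∣p
    ... | inj₁ ()
    ... | inj₂ refl = ℕP.<-irrefl refl m<p′

  -- Φ p (x - 1) = x^p - 1 = (x - 1)(1 + x + ⋯ + x^(p-1)).
  Φ-prime : ∀ p → Prime p → Φ p ≈ geometric 1 p
  Φ-prime zero p-prime = ⊥-elim (¬prime[0] p-prime)
  Φ-prime (suc zero) p-prime = ⊥-elim (¬prime[1] p-prime)
  Φ-prime (suc (suc p″)) p-prime = monic-cancelˡ (monic-xpm1 0) (Φ p) (geometric 1 p) (begin
      mulP (xpm1 1) (Φ p)                          ≈⟨ mul-congˡ (Φ p) (≈-trans (≡⇒≈ (cong ∏Φ (divisorsUpTo-prime p′ p-prime p′ (s≤s z≤n) ℕP.≤-refl))) ∏Φ-[ 1 ]) ⟨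
      mulP (∏Φ (divisorsUpTo p p′)) (Φ p)          ≈⟨ xpm1≈∏Φ*Φ p′ (Φ-spec p (s≤s z≤n)) ⟨
      xpm1 p                                       ≡⟨ cong xpm1 (ℕP.*-identityʳ p) ⟨
      xpm1 (p ℕ.* 1)                               ≈⟨ xpm1≈X^-1 (p ℕ.* 1) ⟩
      X^-1 (p ℕ.* 1)                               ≈⟨ geometric-spec 1 p ⟩
      mulP (X^-1 1) (geometric 1 p)                ≈⟨ mul-congˡ (geometric 1 p) (xpm1≈X^-1 1) ⟨
      mulP (xpm1 1) (geometric 1 p)                ∎)
    where
    open ≈-Reasoning
    p′ = suc p″
    p = suc p′

module ColumnSums where

  open import Defs
  open Polynomial
  open MonicDivision
  open Divisibility
  open import Data.Nat as ℕ using (ℕ; zero; suc; s≤s; _≤_)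
  import Data.Nat.Properties as ℕP
  open import Data.Integer as ℤ using (ℤ; +_; _+_; _*_; -_; _-_)
  import Data.Integer.Properties as ℤP
  open import Data.List as L using ([]; _∷_; length)
  import Data.List.Properties as LP
  open import Data.Vec as V using (Vec; []; _∷_; concat; zipWith; transpose)
  import Data.Vec.Properties as VP
  open import Data.Bool using (Bool; true; false; if_then_else_)
  open import Data.Product using (_,_)
  open import Relation.Binary.PropositionalEquality
  open Solver using (solve; _:+_; _:*_; _:-_; _:=_; con)

  ones : ∀ {n} → Vec Bool n → ℕ
  ones [] = 0
  ones (true ∷ v) = suc (ones v)
  ones (false ∷ v) = ones v

  bit : Bool → ℤ
  bit b = if b then + 1 else + 0

  polyOf-++ : ∀ {m n} (u : Vec Bool m) (v : Vec Bool n) → polyOf (u V.++ v) ≡ polyOf u L.++ polyOf v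
  polyOf-++ [] v = refl
  polyOf-++ (b ∷ u) v = cong (bit b ∷_) (polyOf-++ u v)

  length-polyOf : ∀ {n} (v : Vec Bool n) → length (polyOf v) ≡ n
  length-polyOf [] = refl
  length-polyOf (b ∷ v) = cong suc (length-polyOf v)

  ++≈shift : ∀ xs ys → xs L.++ ys ≈ addP xs (mulP (X^ (length xs)) ys)
  ++≈shift [] ys = ≈-sym (mul-identityˡ ys)
  ++≈shift (x ∷ xs) ys = mk≈ h
    where
    h : (x ∷ xs) L.++ ys ≋ addP (x ∷ xs) (mulP (X^ (suc (length xs))) ys)
    h zero = trans (sym (ℤP.+-identityʳ x)) (sym (trans (coeff-add (x ∷ xs) (mulP (X^ (suc (length xs))) ys) zero) (cong (λ z → x + z) (at (mul-shiftˡ (X^ (length xs)) ys) zero))))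
    h (suc i) = trans (at (++≈shift xs ys) i) (sym (trans (coeff-add (x ∷ xs) (mulP (X^ (suc (length xs))) ys) (suc i))
                   (trans (cong (λ z → coeff xs i + z) (at (mul-shiftˡ (X^ (length xs)) ys) (suc i))) (sym (coeff-add xs (mulP (X^ (length xs)) ys) i)))))

  sumRows : ∀ {N d} → Vec (Vec Bool d) N → Poly
  sumRows [] = []
  sumRows (r ∷ rs) = addP (polyOf r) (sumRows rs)

  cofactor : ∀ {N d} → Vec (Vec Bool d) N → Poly
  cofactor [] = []
  cofactor (r ∷ rs) = addP (cofactor rs) (polyOf (concat rs))

  polyOf-concat≈ : ∀ {N d} (rows : Vec (Vec Bool d) N) → polyOf (concat rows) ≈ addP (sumRows rows) (mulP (xpm1 d) (cofactor rows))
  polyOf-concat≈ {d = d} [] = ≈-sym (mul-zeroʳ (xpm1 d))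
  polyOf-concat≈ {suc N} {d} (r ∷ rs) =
    ≈-trans (≡⇒≈ (polyOf-++ r (concat rs)))
     (≈-trans (++≈shift (polyOf r) P)
      (≈-trans (add-cong (≈-refl {polyOf r}) (mul-congˡ P (≡⇒≈ (cong X^ (length-polyOf r)))))
       (≈-trans (split (polyOf r) (X^ d) P)
        (≈-trans (add-cong (add-cong (≈-refl {polyOf r}) (≈-trans (polyOf-concat≈ rs) (add-cong (≈-refl {sumRows rs}) (mul-congˡ (cofactor rs) (xpm1≈X^-1 d))))) (≈-refl {mulP (subP (X^ d) oneP) P}))
         (≈-trans (regroup (polyOf r) (sumRows rs) (subP (X^ d) oneP) (cofactor rs) P)
           (add-cong (≈-refl {addP (polyOf r) (sumRows rs)}) (mul-congˡ (addP (cofactor rs) P) (≈-sym (xpm1≈X^-1 d)))))))))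
    where
    P = polyOf (concat rs)
    split : ∀ a Xd P → addP a (mulP Xd P) ≈ addP (addP a P) (mulP (subP Xd oneP) P)
    split = solve 3 (λ a Xd P → a :+ Xd :* P := (a :+ P) :+ (Xd :- con (+ 1)) :* P) ≈-refl
    regroup : ∀ a R Y Hs P → addP (addP a (addP R (mulP Y Hs))) (mulP Y P) ≈ addP (addP a R) (mulP Y (addP Hs P))
    regroup = solve 5 (λ a R Y Hs P → (a :+ (R :+ Y :* Hs)) :+ Y :* P := (a :+ R) :+ Y :* (Hs :+ P)) ≈-refl

  columnSums : ∀ {N d} → Vec (Vec Bool N) d → Poly
  columnSums [] = []
  columnSums (c ∷ cs) = (+ ones c) ∷ columnSums cs

  ∷-cong : ∀ {x y p q} → x ≡ y → p ≈ q → (x ∷ p) ≈ (y ∷ q)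
  ∷-cong x≡y p≈q = mk≈ λ { zero → x≡y ; (suc i) → at p≈q i }

  sumRows-zipWith : ∀ {N d} (col : Vec Bool N) (rows : Vec (Vec Bool d) N) → sumRows (zipWith _∷_ col rows) ≈ (+ ones col) ∷ sumRows rows
  sumRows-zipWith [] [] = mk≈ λ { zero → refl ; (suc i) → refl }
  sumRows-zipWith (b ∷ col) (r ∷ rows) =
    ≈-trans (add-cong (≈-refl {bit b ∷ polyOf r}) (sumRows-zipWith col rows)) (∷-cong (bit+ones b) (≈-refl {addP (polyOf r) (sumRows rows)}))
    where
    bit+ones : ∀ b → bit b + (+ ones col) ≡ + ones (b ∷ col)
    bit+ones true = refl
    bit+ones false = refl

  sumRows-replicate : ∀ N → sumRows (V.replicate N ([] {A = Bool})) ≈ []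
  sumRows-replicate zero = ≈-refl
  sumRows-replicate (suc N) = sumRows-replicate N

  sumRows-transpose : ∀ {N d} (cols : Vec (Vec Bool N) d) → sumRows (transpose cols) ≈ columnSums cols
  sumRows-transpose {N} [] = sumRows-replicate N
  sumRows-transpose (c ∷ cs) =
    ≈-trans (≡⇒≈ (cong sumRows (sym (VP.zipWith-is-⊛ _∷_ c (transpose cs)))))
      (≈-trans (sumRows-zipWith c (transpose cs)) (∷-cong refl (sumRows-transpose cs)))

  -- Reading the coefficients of f as the rows of an N × d matrix, f ≡ columnSums modulo x^d - 1.
  polyOf-concat-transpose : ∀ {N d} (cols : Vec (Vec Bool N) d) → polyOf (concat (transpose cols)) ≈ addP (columnSums cols) (mulP (xpm1 d) (cofactor (transpose cols)))
  polyOf-concat-transpose {N} {d} cols = ≈-trans (polyOf-concat≈ (transpose cols)) (add-cong (sumRows-transpose cols) (≈-refl {mulP (xpm1 d) (cofactor (transpose cols))}))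

  ∣-mod⇒∣ʳ : ∀ {Φp f g X H} → Φp ∣≈ X → f ≈ addP g (mulP X H) → Φp ∣≈ f → Φp ∣≈ g
  ∣-mod⇒∣ʳ {Φp} {f} {g} {X} {H} (m , em) ef (k , ek) = subP k (mulP m H) ,
    ≈-trans (expand Φp k m H) (≈-trans (sub-cong (≈-trans ek ef) (mul-congˡ H em)) (cancel g X H))
    where
    expand : ∀ Φp k m H → mulP Φp (subP k (mulP m H)) ≈ subP (mulP Φp k) (mulP (mulP Φp m) H)
    expand = solve 4 (λ Φp k m H → Φp :* (k :- m :* H) := Φp :* k :- (Φp :* m) :* H) ≈-refl
    cancel : ∀ g X H → subP (addP g (mulP X H)) (mulP X H) ≈ g
    cancel = solve 3 (λ g X H → (g :+ X :* H) :- X :* H := g) ≈-refl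

  ∣-mod⇒∣ˡ : ∀ {Φp f g X H} → Φp ∣≈ X → f ≈ addP g (mulP X H) → Φp ∣≈ g → Φp ∣≈ f
  ∣-mod⇒∣ˡ {Φp} {f} {g} {X} {H} (m , em) ef (k , ek) = addP k (mulP m H) ,
    ≈-trans (expand Φp k m H) (≈-trans (add-cong ek (mul-congˡ H em)) (≈-sym ef))
    where
    expand : ∀ Φp k m H → mulP Φp (addP k (mulP m H)) ≈ addP (mulP Φp k) (mulP (mulP Φp m) H)
    expand = solve 4 (λ Φp k m H → Φp :* (k :+ m :* H) := Φp :* k :+ (Φp :* m) :* H) ≈-refl

  ∣-monic-coeffs≥⇒≡ : ∀ {D Φp g₁ g₂} → Monic D Φp → Φp ∣≈ g₁ → Φp ∣≈ g₂ → (∀ i → D ≤ i → coeff g₁ i ≡ coeff g₂ i) → ∀ i → coeff g₁ i ≡ coeff g₂ i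
  ∣-monic-coeffs≥⇒≡ {D} {Φp} {g₁} {g₂} monic (h₁ , e₁) (h₂ , e₂) high i =
    ℤP.i-j≡0⇒i≡j (coeff g₁ i) (coeff g₂ i) (trans (sym (coeff-sub g₁ g₂ i)) (at g₁-g₂≈[] i))
    where
    distrib : ∀ Φp h₁ h₂ → mulP Φp (subP h₁ h₂) ≈ subP (mulP Φp h₁) (mulP Φp h₂)
    distrib = solve 3 (λ Φp h₁ h₂ → Φp :* (h₁ :- h₂) := Φp :* h₁ :- Φp :* h₂) ≈-refl
    Φ*[h₁-h₂] : mulP Φp (subP h₁ h₂) ≈ subP g₁ g₂
    Φ*[h₁-h₂] = ≈-trans (distrib Φp h₁ h₂) (sub-cong e₁ e₂)
    low : DegBelow D (subP g₁ g₂)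
    low j D≤j = trans (coeff-sub g₁ g₂ j) (trans (cong (_- coeff g₂ j) (high j D≤j)) (ℤP.+-inverseʳ (coeff g₂ j)))
    h₁-h₂≈[] : subP h₁ h₂ ≈ []
    h₁-h₂≈[] = degBelow-*-monic⇒≈[] monic (subP h₁ h₂) (degBelow-cong (≈-sym (≈-trans (mul-comm (subP h₁ h₂) Φp) Φ*[h₁-h₂])) low)
    g₁-g₂≈[] : subP g₁ g₂ ≈ []
    g₁-g₂≈[] = ≈-trans (≈-sym Φ*[h₁-h₂]) (≈-trans (mul-congʳ Φp h₁-h₂≈[]) (mul-zeroʳ Φp))

  coeff-columnSums-++-≥ : ∀ {N D m} (x y : Vec (Vec Bool N) D) (z : Vec (Vec Bool N) m) i → D ≤ i →
                          coeff (columnSums (x V.++ z)) i ≡ coeff (columnSums (y V.++ z)) i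
  coeff-columnSums-++-≥ [] [] z i _ = refl
  coeff-columnSums-++-≥ (c ∷ x) (c′ ∷ y) z (suc i) (s≤s D≤i) = coeff-columnSums-++-≥ x y z i D≤i

  columnSums-++-injective : ∀ {N D m} (x y : Vec (Vec Bool N) D) (z : Vec (Vec Bool N) m) →
                            (∀ i → coeff (columnSums (x V.++ z)) i ≡ coeff (columnSums (y V.++ z)) i) → V.map ones x ≡ V.map ones y
  columnSums-++-injective [] [] z same = refl
  columnSums-++-injective (c ∷ x) (c′ ∷ y) z same = cong₂ _∷_ (ℤP.+-injective (same zero)) (columnSums-++-injective x y z (λ i → same (suc i)))

  columnSums-replicate : ∀ {N p} (cols : Vec (Vec Bool N) p) k → V.map ones cols ≡ V.replicate p k → columnSums cols ≡ L.replicate p (+ k)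
  columnSums-replicate [] k e = refl
  columnSums-replicate (c ∷ cols) k e = cong₂ _∷_ (cong +_ (VP.∷-injectiveˡ e)) (columnSums-replicate cols k (VP.∷-injectiveʳ e))

  replicate-suc-snoc : ∀ p (a : ℤ) → L.replicate (suc p) a ≡ L.replicate p a L.++ (a ∷ [])
  replicate-suc-snoc zero a = refl
  replicate-suc-snoc (suc p) a = cong (a ∷_) (replicate-suc-snoc p a)

  replicate≈geometric : ∀ p → L.replicate p (+ 1) ≈ geometric 1 p
  replicate≈geometric zero = ≈-refl
  replicate≈geometric (suc p) =
    ≈-trans (≡⇒≈ (replicate-suc-snoc p (+ 1)))
     (≈-trans (snoc≈ (L.replicate p (+ 1)) (+ 1))
      (≈-trans (add-cong (replicate≈geometric p) (≡⇒≈ (cong X^ (trans (LP.length-replicate p) (sym (ℕP.*-identityʳ p))))))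
        (add-comm (geometric 1 p) (X^ (p ℕ.* 1)))))

  const*replicate : ∀ p k → mulP (const k) (L.replicate p (+ 1)) ≈ L.replicate p k
  const*replicate p k = mk≈ λ i → trans (coeff-const-mul k (L.replicate p (+ 1)) i) (scale p i)
    where
    scale : ∀ p i → k * coeff (L.replicate p (+ 1)) i ≡ coeff (L.replicate p k) i
    scale zero i = ℤP.*-zeroʳ k
    scale (suc p) zero = ℤP.*-identityʳ k
    scale (suc p) (suc i) = scale p i

module Expectation (q : ℚ) where

  open import Defs
  open import Data.Nat as ℕ using (ℕ; zero; suc)
  open import Data.Rational as ℚ using (ℚ; 0ℚ; 1ℚ; _+_; _*_; _-_; _≤_)
  import Data.Rational.Properties as ℚP
  open import Data.Rational.Solver using (module +-*-Solver)
  open import Data.Vec as V using (Vec; []; _∷_; _++_; concat; zipWith; transpose)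
  open import Data.Vec.Properties using (zipWith-is-⊛)
  open import Data.Bool using (Bool; true; false; if_then_else_)
  open import Data.List as L using (List)
  open import Data.List.Properties using (map-++)
  open import Relation.Nullary using (does; Dec)
  open import Relation.Binary.PropositionalEquality
  open +-*-Solver

  𝔼₁ : (Bool → ℚ) → ℚ
  𝔼₁ H = q * H true + (1ℚ - q) * H false

  𝔼 : (n : ℕ) → (Vec Bool n → ℚ) → ℚ
  𝔼 zero F = F []
  𝔼 (suc n) F = 𝔼₁ (λ b → 𝔼 n (λ v → F (b ∷ v)))

  𝔼₁-cong : ∀ {x y z w} → x ≡ z → y ≡ w → q * x + (1ℚ - q) * y ≡ q * z + (1ℚ - q) * w
  𝔼₁-cong e1 e2 = cong₂ (λ x y → q * x + (1ℚ - q) * y) e1 e2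

  𝔼-cong : ∀ n {F G : Vec Bool n → ℚ} → (∀ c → F c ≡ G c) → 𝔼 n F ≡ 𝔼 n G
  𝔼-cong zero h = h []
  𝔼-cong (suc n) h = 𝔼₁-cong (𝔼-cong n (λ v → h (true ∷ v))) (𝔼-cong n (λ v → h (false ∷ v)))

  𝔼₁-linear : ∀ a b H K → 𝔼₁ (λ x → a * H x + b * K x) ≡ a * 𝔼₁ H + b * 𝔼₁ K
  𝔼₁-linear a b H K = solve 8 (λ q r a b h1 h2 k1 k2 → q :* (a :* h1 :+ b :* k1) :+ r :* (a :* h2 :+ b :* k2)
                              := a :* (q :* h1 :+ r :* h2) :+ b :* (q :* k1 :+ r :* k2)) refl q (1ℚ - q) a b (H true) (H false) (K true) (K false)

  𝔼-linear : ∀ n a b (F G : Vec Bool n → ℚ) → 𝔼 n (λ c → a * F c + b * G c) ≡ a * 𝔼 n F + b * 𝔼 n G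
  𝔼-linear zero a b F G = refl
  𝔼-linear (suc n) a b F G =
    trans (𝔼₁-cong (𝔼-linear n a b (λ v → F (true ∷ v)) (λ v → G (true ∷ v))) (𝔼-linear n a b (λ v → F (false ∷ v)) (λ v → G (false ∷ v))))
      (𝔼₁-linear a b (λ x → 𝔼 n (λ v → F (x ∷ v))) (λ x → 𝔼 n (λ v → G (x ∷ v))))

  𝔼-const : ∀ n k → 𝔼 n (λ _ → k) ≡ k
  𝔼-const zero k = refl
  𝔼-const (suc n) k = trans (𝔼₁-cong (𝔼-const n k) (𝔼-const n k))
    (solve 2 (λ q k → q :* k :+ (con 1ℚ :- q) :* k := k) refl q k)

  𝔼-scale : ∀ n a (F : Vec Bool n → ℚ) → 𝔼 n (λ c → a * F c) ≡ a * 𝔼 n F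
  𝔼-scale zero a F = refl
  𝔼-scale (suc n) a F =
    trans (𝔼₁-cong (𝔼-scale n a (λ v → F (true ∷ v))) (𝔼-scale n a (λ v → F (false ∷ v))))
      (solve 4 (λ q a x y → q :* (a :* x) :+ (con 1ℚ :- q) :* (a :* y) := a :* (q :* x :+ (con 1ℚ :- q) :* y)) refl q a _ _)

  𝔼-++ : ∀ a b (F : Vec Bool (a ℕ.+ b) → ℚ) → 𝔼 (a ℕ.+ b) F ≡ 𝔼 a (λ u → 𝔼 b (λ v → F (u ++ v)))
  𝔼-++ zero b F = refl
  𝔼-++ (suc a) b F = 𝔼₁-cong (𝔼-++ a b (λ w → F (true ∷ w))) (𝔼-++ a b (λ w → F (false ∷ w)))

  𝔼-swap : ∀ a b (G : Vec Bool a → Vec Bool b → ℚ) → 𝔼 a (λ u → 𝔼 b (λ v → G u v)) ≡ 𝔼 b (λ v → 𝔼 a (λ u → G u v))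
  𝔼-swap zero b G = refl
  𝔼-swap (suc a) b G =
    trans (𝔼₁-cong (𝔼-swap a b (λ u v → G (true ∷ u) v)) (𝔼-swap a b (λ u v → G (false ∷ u) v)))
      (sym (𝔼-linear b q (1ℚ - q) (λ v → 𝔼 a (λ u → G (true ∷ u) v)) (λ v → 𝔼 a (λ u → G (false ∷ u) v))))

  sumℚ-++ : ∀ xs ys → sumℚ (xs L.++ ys) ≡ sumℚ xs + sumℚ ys
  sumℚ-++ L.[] ys = sym (ℚP.+-identityˡ (sumℚ ys))
  sumℚ-++ (x L.∷ xs) ys = trans (cong (x +_) (sumℚ-++ xs ys)) (sym (ℚP.+-assoc x (sumℚ xs) (sumℚ ys)))

  sumℚ-concatMap : ∀ {A C : Set} (f : C → ℚ) (h : A → List C) (xs : List A) →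
                  sumℚ (L.map f (L.concatMap h xs)) ≡ sumℚ (L.map (λ v → sumℚ (L.map f (h v))) xs)
  sumℚ-concatMap f h L.[] = refl
  sumℚ-concatMap f h (x L.∷ xs) =
    trans (cong sumℚ (map-++ f (h x) (L.concatMap h xs)))
      (trans (sumℚ-++ (L.map f (h x)) (L.map f (L.concatMap h xs))) (cong (sumℚ (L.map f (h x)) +_) (sumℚ-concatMap f h xs)))

  sumℚ-linear : ∀ {A : Set} a b (F G : A → ℚ) (xs : List A) → sumℚ (L.map (λ v → a * F v + b * G v) xs) ≡ a * sumℚ (L.map F xs) + b * sumℚ (L.map G xs)
  sumℚ-linear a b F G L.[] = solve 2 (λ a b → con 0ℚ := a :* con 0ℚ :+ b :* con 0ℚ) refl a b
  sumℚ-linear a b F G (x L.∷ xs) =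
    trans (cong (a * F x + b * G x +_) (sumℚ-linear a b F G xs))
      (solve 6 (λ a b f g s t → a :* f :+ b :* g :+ (a :* s :+ b :* t) := a :* (f :+ s) :+ b :* (g :+ t)) refl a b (F x) (G x) (sumℚ (L.map F xs)) (sumℚ (L.map G xs)))

  sumℚ-cong : ∀ {A : Set} {F G : A → ℚ} (xs : List A) → (∀ x → F x ≡ G x) → sumℚ (L.map F xs) ≡ sumℚ (L.map G xs)
  sumℚ-cong L.[] h = refl
  sumℚ-cong (x L.∷ xs) h = cong₂ _+_ (h x) (sumℚ-cong xs h)

  sumℚ-weighted≡𝔼 : ∀ n (G : Vec Bool n → ℚ) → sumℚ (L.map (λ c → weight q c * G c) (allVecs n)) ≡ 𝔼 n G
  sumℚ-weighted≡𝔼 zero G = solve 1 (λ g → con 1ℚ :* g :+ con 0ℚ := g) refl (G [])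
  sumℚ-weighted≡𝔼 (suc n) G =
    trans (sumℚ-concatMap (λ c → weight q c * G c) (λ v → (true ∷ v) L.∷ (false ∷ v) L.∷ L.[]) (allVecs n))
     (trans (sumℚ-cong (allVecs n) (λ v → solve 5 (λ q w gt gf r → (q :* w) :* gt :+ ((r :* w) :* gf :+ con 0ℚ) := q :* (w :* gt) :+ r :* (w :* gf)) refl q (weight q v) (G (true ∷ v)) (G (false ∷ v)) (1ℚ - q)))
      (trans (sumℚ-linear q (1ℚ - q) (λ v → weight q v * G (true ∷ v)) (λ v → weight q v * G (false ∷ v)) (allVecs n))
        (𝔼₁-cong (sumℚ-weighted≡𝔼 n (λ v → G (true ∷ v))) (sumℚ-weighted≡𝔼 n (λ v → G (false ∷ v))))))

  𝟙 : ∀ {X : Set} {A : X → Set} → (∀ x → Dec (A x)) → X → ℚ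
  𝟙 A? x = if does (A? x) then 1ℚ else 0ℚ

  Prob≡𝔼 : ∀ n {P : Vec Bool n → Set} (P? : ∀ c → Dec (P c)) → Prob q n P? ≡ 𝔼 n (𝟙 P?)
  Prob≡𝔼 n P? = trans (sumℚ-cong (allVecs n) weight-𝟙) (sumℚ-weighted≡𝔼 n (𝟙 P?))
    where
    weight-𝟙 : ∀ c → (if does (P? c) then weight q c else 0ℚ) ≡ weight q c * 𝟙 P? c
    weight-𝟙 c with does (P? c)
    ... | true = sym (ℚP.*-identityʳ (weight q c))
    ... | false = sym (ℚP.*-zeroʳ (weight q c))

  𝔼ᴹ : (N d : ℕ) → (Vec (Vec Bool d) N → ℚ) → ℚ
  𝔼ᴹ zero d F = F []
  𝔼ᴹ (suc N) d F = 𝔼 d (λ r → 𝔼ᴹ N d (λ rs → F (r ∷ rs)))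

  𝔼ᴹ-cong : ∀ N d {F G : Vec (Vec Bool d) N → ℚ} → (∀ c → F c ≡ G c) → 𝔼ᴹ N d F ≡ 𝔼ᴹ N d G
  𝔼ᴹ-cong zero d h = h []
  𝔼ᴹ-cong (suc N) d h = 𝔼-cong d (λ r → 𝔼ᴹ-cong N d (λ rs → h (r ∷ rs)))

  𝔼ᴹ-scale : ∀ N d a (F : Vec (Vec Bool d) N → ℚ) → 𝔼ᴹ N d (λ c → a * F c) ≡ a * 𝔼ᴹ N d F
  𝔼ᴹ-scale zero d a F = refl
  𝔼ᴹ-scale (suc N) d a F = trans (𝔼-cong d (λ r → 𝔼ᴹ-scale N d a (λ rs → F (r ∷ rs)))) (𝔼-scale d a (λ r → 𝔼ᴹ N d (λ rs → F (r ∷ rs))))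

  𝔼ᴹ-const : ∀ N d k → 𝔼ᴹ N d (λ _ → k) ≡ k
  𝔼ᴹ-const zero d k = refl
  𝔼ᴹ-const (suc N) d k = trans (𝔼-cong d (λ r → 𝔼ᴹ-const N d k)) (𝔼-const d k)

  𝔼-concat : ∀ N d (F : Vec Bool (N ℕ.* d) → ℚ) → 𝔼 (N ℕ.* d) F ≡ 𝔼ᴹ N d (λ rs → F (concat rs))
  𝔼-concat zero d F = refl
  𝔼-concat (suc N) d F = trans (𝔼-++ d (N ℕ.* d) F) (𝔼-cong d (λ u → 𝔼-concat N d (λ v → F (u ++ v))))

  𝔼-𝔼ᴹ-swap : ∀ n N d (G : Vec Bool n → Vec (Vec Bool d) N → ℚ) → 𝔼 n (λ u → 𝔼ᴹ N d (λ y → G u y)) ≡ 𝔼ᴹ N d (λ y → 𝔼 n (λ u → G u y))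
  𝔼-𝔼ᴹ-swap n zero d G = refl
  𝔼-𝔼ᴹ-swap n (suc N) d G = trans (𝔼-swap n d (λ u r → 𝔼ᴹ N d (λ rs → G u (r ∷ rs))))
    (𝔼-cong d (λ r → 𝔼-𝔼ᴹ-swap n N d (λ u rs → G u (r ∷ rs))))

  𝔼ᴹ-swap : ∀ a b N (G : Vec (Vec Bool N) a → Vec (Vec Bool N) b → ℚ) → 𝔼ᴹ a N (λ x → 𝔼ᴹ b N (λ y → G x y)) ≡ 𝔼ᴹ b N (λ y → 𝔼ᴹ a N (λ x → G x y))
  𝔼ᴹ-swap zero b N G = refl
  𝔼ᴹ-swap (suc a) b N G = trans (𝔼-cong N (λ c → 𝔼ᴹ-swap a b N (λ xs y → G (c ∷ xs) y)))
    (𝔼-𝔼ᴹ-swap N b N (λ c y → 𝔼ᴹ a N (λ xs → G (c ∷ xs) y)))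

  𝔼ᴹ-++ : ∀ a b N (F : Vec (Vec Bool N) (a ℕ.+ b) → ℚ) → 𝔼ᴹ (a ℕ.+ b) N F ≡ 𝔼ᴹ a N (λ x → 𝔼ᴹ b N (λ y → F (x ++ y)))
  𝔼ᴹ-++ zero b N F = refl
  𝔼ᴹ-++ (suc a) b N F = 𝔼-cong N (λ c → 𝔼ᴹ-++ a b N (λ w → F (c ∷ w)))

  𝔼ᴹ-no-columns : ∀ N (F : Vec (Vec Bool 0) N → ℚ) → 𝔼ᴹ N 0 F ≡ F (V.replicate N [])
  𝔼ᴹ-no-columns zero F = refl
  𝔼ᴹ-no-columns (suc N) F = 𝔼ᴹ-no-columns N (λ rs → F ([] ∷ rs))

  𝔼ᴹ-first-column : ∀ N d (F : Vec (Vec Bool (suc d)) N → ℚ) → 𝔼ᴹ N (suc d) F ≡ 𝔼 N (λ col → 𝔼ᴹ N d (λ rows → F (zipWith _∷_ col rows)))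
  𝔼ᴹ-first-column zero d F = refl
  𝔼ᴹ-first-column (suc N) d F =
    trans (𝔼₁-cong (𝔼-cong d (λ r′ → 𝔼ᴹ-first-column N d (λ rs → F ((true ∷ r′) ∷ rs)))) (𝔼-cong d (λ r′ → 𝔼ᴹ-first-column N d (λ rs → F ((false ∷ r′) ∷ rs)))))
      (𝔼₁-cong (𝔼-swap d N (λ r′ col → 𝔼ᴹ N d (λ rows → F ((true ∷ r′) ∷ zipWith _∷_ col rows))))
              (𝔼-swap d N (λ r′ col → 𝔼ᴹ N d (λ rows → F ((false ∷ r′) ∷ zipWith _∷_ col rows)))))

  𝔼ᴹ-transpose : ∀ N d (F : Vec (Vec Bool d) N → ℚ) → 𝔼ᴹ N d F ≡ 𝔼ᴹ d N (λ cols → F (transpose cols))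
  𝔼ᴹ-transpose N zero F = 𝔼ᴹ-no-columns N F
  𝔼ᴹ-transpose N (suc d) F =
    trans (𝔼ᴹ-first-column N d F)
      (𝔼-cong N (λ col → trans (𝔼ᴹ-transpose N d (λ rows → F (zipWith _∷_ col rows)))
                               (𝔼ᴹ-cong d N (λ cols → cong F (zipWith-is-⊛ _∷_ col (transpose cols))))))

  module Monotone (0≤q : 0ℚ ≤ q) (0≤1-q : 0ℚ ≤ 1ℚ - q) where

    private
      *-monoʳ-≤-nonNeg : ∀ {r x y} → 0ℚ ≤ r → x ≤ y → r * x ≤ r * y
      *-monoʳ-≤-nonNeg {r} 0≤r = ℚP.*-monoˡ-≤-nonNeg r {{ℚ.nonNegative 0≤r}}

    𝔼-mono : ∀ n {F G : Vec Bool n → ℚ} → (∀ c → F c ≤ G c) → 𝔼 n F ≤ 𝔼 n G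
    𝔼-mono zero h = h []
    𝔼-mono (suc n) h = ℚP.+-mono-≤ (*-monoʳ-≤-nonNeg 0≤q (𝔼-mono n (λ v → h (true ∷ v)))) (*-monoʳ-≤-nonNeg 0≤1-q (𝔼-mono n (λ v → h (false ∷ v))))

    𝔼ᴹ-mono : ∀ N d {F G : Vec (Vec Bool d) N → ℚ} → (∀ c → F c ≤ G c) → 𝔼ᴹ N d F ≤ 𝔼ᴹ N d G
    𝔼ᴹ-mono zero d h = h []
    𝔼ᴹ-mono (suc N) d h = 𝔼-mono d (λ r → 𝔼ᴹ-mono N d (λ rs → h (r ∷ rs)))

    𝔼-nonNeg : ∀ n {F : Vec Bool n → ℚ} → (∀ c → 0ℚ ≤ F c) → 0ℚ ≤ 𝔼 n F
    𝔼-nonNeg n {F} h = subst (_≤ 𝔼 n F) (𝔼-const n 0ℚ) (𝔼-mono n h)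

    𝔼ᴹ-nonNeg : ∀ N d {F : Vec (Vec Bool d) N → ℚ} → (∀ c → 0ℚ ≤ F c) → 0ℚ ≤ 𝔼ᴹ N d F
    𝔼ᴹ-nonNeg N d {F} h = subst (_≤ 𝔼ᴹ N d F) (𝔼ᴹ-const N d 0ℚ) (𝔼ᴹ-mono N d h)

module Binomial (q : ℚ) where

  open import Defs
  open Expectation q
  open ColumnSums using (ones)
  open import Data.Nat as ℕ using (ℕ; zero; suc; _∸_)
  import Data.Nat.Properties as ℕP
  open import Data.Nat.Combinatorics using (_C_; nCk+nC[k+1]≡[n+1]C[k+1])
  open import Data.Integer using (+_)
  import Data.Integer.Properties as ℤP
  import Data.Nat.Coprimality as Coprimality
  open import Data.Rational as ℚ using (0ℚ; 1ℚ; _+_; _*_; _-_; _≤_; _⊔_)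
  import Data.Rational.Properties as ℚP
  open import Data.Rational.Solver using (module +-*-Solver)
  open import Data.Vec as V using (Vec; []; _∷_)
  open import Data.Vec.Properties using (∷-injectiveˡ; ∷-injectiveʳ)
  open import Data.Bool using (Bool; true; false; if_then_else_; T)
  open import Data.List as L using (List)
  open import Data.List.Membership.Propositional using (_∈_)
  open import Data.List.Membership.Propositional.Properties using (∈-map⁺; ∈-upTo⁺)
  open import Data.List.Relation.Unary.Any using (here; there)
  open import Data.Product using (Σ; _×_; _,_)
  open import Data.Sum using (_⊎_; inj₁; inj₂; [_,_]′)
  open import Data.Empty using (⊥-elim)
  open import Relation.Nullary using (yes; no; Dec)
  open import Relation.Binary.PropositionalEquality
  open +-*-Solver

  ℕtoℚ-+ : ∀ a b → ℕtoℚ (a ℕ.+ b) ≡ ℕtoℚ a + ℕtoℚ b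
  ℕtoℚ-+ a b = sym (trans (cong₂ _+_ (ℕtoℚ≡mkℚ a) (ℕtoℚ≡mkℚ b)) (cong (ℚ._/ 1) (cong₂ Data.Integer._+_ (ℤP.*-identityʳ (+ a)) (ℤP.*-identityʳ (+ b)))))
    where
    ℕtoℚ≡mkℚ : ∀ a → ℕtoℚ a ≡ ℚ.mkℚ (+ a) 0 (Coprimality.sym (Coprimality.1-coprimeTo a))
    ℕtoℚ≡mkℚ a = ℚP.normalize-coprime (Coprimality.sym (Coprimality.1-coprimeTo a))

  nCk≡0 : ∀ n k → n ℕ.< k → n C k ≡ 0
  nCk≡0 n k n<k with k ℕ.≤ᵇ n in eq
  ... | false = refl
  ... | true = ⊥-elim (ℕP.<⇒≱ n<k (ℕP.≤ᵇ⇒≤ k n (subst T (sym eq) _)))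

  0≤1 : 0ℚ ≤ 1ℚ
  0≤1 = ℚP.<⇒≤ (ℚP.positive⁻¹ 1ℚ)

  *-nonNeg : ∀ {x y} → 0ℚ ≤ x → 0ℚ ≤ y → 0ℚ ≤ x * y
  *-nonNeg {x} {y} 0≤x 0≤y = ℚP.nonNegative⁻¹ (x * y) {{ℚP.nonNeg*nonNeg⇒nonNeg x {{ℚ.nonNegative 0≤x}} y {{ℚ.nonNegative 0≤y}}}}

  *-mono-≤-nonNeg : ∀ {a b c d} → 0ℚ ≤ a → 0ℚ ≤ c → a ≤ b → c ≤ d → a * c ≤ b * d
  *-mono-≤-nonNeg {a} {b} {c} {d} 0≤a 0≤c a≤b c≤d =
    ℚP.≤-trans (ℚP.*-monoʳ-≤-nonNeg c {{ℚ.nonNegative 0≤c}} a≤b) (ℚP.*-monoˡ-≤-nonNeg b {{ℚ.nonNegative (ℚP.≤-trans 0≤a a≤b)}} c≤d)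

  ^-nonNeg : ∀ {x} n → 0ℚ ≤ x → 0ℚ ≤ x ^ᵠ n
  ^-nonNeg zero 0≤x = 0≤1
  ^-nonNeg (suc n) 0≤x = *-nonNeg 0≤x (^-nonNeg n 0≤x)

  max₀ : List ℚ → ℚ
  max₀ = L.foldr _⊔_ 0ℚ

  max₀-upper : ∀ {x xs} → x ∈ xs → x ≤ max₀ xs
  max₀-upper {x} {x L.∷ xs} (here refl) = ℚP.p≤p⊔q x (max₀ xs)
  max₀-upper {x} {y L.∷ xs} (there x∈) = ℚP.≤-trans (max₀-upper x∈) (ℚP.p≤q⊔p y (max₀ xs))

  max₀-nonNeg : ∀ xs → 0ℚ ≤ max₀ xs
  max₀-nonNeg L.[] = ℚP.≤-refl
  max₀-nonNeg (y L.∷ xs) = ℚP.≤-trans (max₀-nonNeg xs) (ℚP.p≤q⊔p y (max₀ xs))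

  max₀-map-attained : ∀ (f : ℕ → ℚ) xs → max₀ (L.map f xs) ≡ 0ℚ ⊎ Σ ℕ (λ k → max₀ (L.map f xs) ≡ f k)
  max₀-map-attained f L.[] = inj₁ refl
  max₀-map-attained f (y L.∷ xs) with ℚP.⊔-sel (f y) (max₀ (L.map f xs))
  ... | inj₁ eq = inj₂ (y , eq)
  ... | inj₂ eq with max₀-map-attained f xs
  ...   | inj₁ ≡0 = inj₁ (trans eq ≡0)
  ...   | inj₂ (k , ≡fk) = inj₂ (k , trans eq ≡fk)

  𝟙≡ : ℕ → ℕ → ℚ
  𝟙≡ a b = if a ℕ.≡ᵇ b then 1ℚ else 0ℚ

  𝟙≡-nonNeg : ∀ a b → 0ℚ ≤ 𝟙≡ a b
  𝟙≡-nonNeg a b with a ℕ.≡ᵇ b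
  ... | true = 0≤1
  ... | false = ℚP.≤-refl

  binomial : ℕ → ℕ → ℚ
  binomial N k = ℕtoℚ (N C k) * (q ^ᵠ k) * ((1ℚ - q) ^ᵠ (N ∸ k))

  binomial-beyond : ∀ N k → N ℕ.< k → binomial N k ≡ 0ℚ
  binomial-beyond N k N<k =
    trans (cong (λ c → ℕtoℚ c * (q ^ᵠ k) * ((1ℚ - q) ^ᵠ (N ∸ k))) (nCk≡0 N k N<k))
      (trans (cong (_* ((1ℚ - q) ^ᵠ (N ∸ k))) (ℚP.*-zeroˡ (q ^ᵠ k))) (ℚP.*-zeroˡ ((1ℚ - q) ^ᵠ (N ∸ k))))

  binomial-suc-< : ∀ N k → k ℕ.< N → binomial (suc N) (suc k) ≡ q * binomial N k + (1ℚ - q) * binomial N (suc k)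
  binomial-suc-< N k k<N =
    begin
      ℕtoℚ (suc N C suc k) * (q * Qk) * R
    ≡⟨ cong₂ (λ c r → c * (q * Qk) * r) (trans (cong ℕtoℚ (sym (nCk+nC[k+1]≡[n+1]C[k+1] N k))) (ℕtoℚ-+ (N C k) (N C suc k))) R≡ ⟩
      (C₁ + C₂) * (q * Qk) * ((1ℚ - q) * R′)
    ≡⟨ solve 6 (λ q r C₁ C₂ Qk R′ → (C₁ :+ C₂) :* (q :* Qk) :* (r :* R′) := q :* (C₁ :* Qk :* (r :* R′)) :+ r :* (C₂ :* (q :* Qk) :* R′)) refl q (1ℚ - q) C₁ C₂ Qk R′ ⟩
      q * (C₁ * Qk * ((1ℚ - q) * R′)) + (1ℚ - q) * (C₂ * (q * Qk) * R′)
    ≡⟨ cong (λ r → q * (C₁ * Qk * r) + (1ℚ - q) * (C₂ * (q * Qk) * R′)) R≡ ⟨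
      q * binomial N k + (1ℚ - q) * binomial N (suc k)
    ∎
    where
    open ≡-Reasoning
    C₁ = ℕtoℚ (N C k)
    C₂ = ℕtoℚ (N C suc k)
    Qk = q ^ᵠ k
    R = (1ℚ - q) ^ᵠ (N ∸ k)
    R′ = (1ℚ - q) ^ᵠ (N ∸ suc k)
    R≡ : R ≡ (1ℚ - q) * R′
    R≡ = cong ((1ℚ - q) ^ᵠ_) (ℕP.+-∸-assoc 1 k<N)

  binomial-suc-≥ : ∀ N k → N ℕ.≤ k → binomial (suc N) (suc k) ≡ q * binomial N k + (1ℚ - q) * binomial N (suc k)
  binomial-suc-≥ N k N≤k =
    begin
      ℕtoℚ (suc N C suc k) * (q * Qk) * R
    ≡⟨ cong (λ c → c * (q * Qk) * R) (trans (cong ℕtoℚ (sym (nCk+nC[k+1]≡[n+1]C[k+1] N k))) (trans (ℕtoℚ-+ (N C k) (N C suc k)) (cong (λ c → C₁ + ℕtoℚ c) (nCk≡0 N (suc k) (ℕ.s≤s N≤k))))) ⟩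
      (C₁ + 0ℚ) * (q * Qk) * R
    ≡⟨ trans (cong (λ c → c * (q * Qk) * R) (ℚP.+-identityʳ C₁)) (solve 4 (λ q r C₁ Qk → C₁ :* (q :* Qk) :* r := q :* (C₁ :* Qk :* r)) refl q R C₁ Qk) ⟩
      q * binomial N k
    ≡⟨ ℚP.+-identityʳ (q * binomial N k) ⟨
      q * binomial N k + 0ℚ
    ≡⟨ cong (λ z → q * binomial N k + z) (trans (cong ((1ℚ - q) *_) (binomial-beyond N (suc k) (ℕ.s≤s N≤k))) (ℚP.*-zeroʳ (1ℚ - q))) ⟨
      q * binomial N k + (1ℚ - q) * binomial N (suc k)
    ∎
    where
    open ≡-Reasoning
    C₁ = ℕtoℚ (N C k)
    Qk = q ^ᵠ k
    R = (1ℚ - q) ^ᵠ (N ∸ k)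

  binomial-suc : ∀ N k → binomial (suc N) (suc k) ≡ q * binomial N k + (1ℚ - q) * binomial N (suc k)
  binomial-suc N k = [ binomial-suc-< N k , binomial-suc-≥ N k ]′ (ℕP.<-≤-connex k N)

  𝔼-ones≡binomial : ∀ N k → 𝔼 N (λ c → 𝟙≡ (ones c) k) ≡ binomial N k
  𝔼-ones≡binomial zero zero = refl
  𝔼-ones≡binomial zero (suc k) = sym (binomial-beyond 0 (suc k) (ℕ.s≤s ℕ.z≤n))
  𝔼-ones≡binomial (suc N) zero =
    trans (𝔼₁-cong (𝔼-const N 0ℚ) (𝔼-ones≡binomial N zero))
      (solve 3 (λ q r R → q :* con 0ℚ :+ r :* (con 1ℚ :* con 1ℚ :* R) := con 1ℚ :* con 1ℚ :* (r :* R)) refl q (1ℚ - q) ((1ℚ - q) ^ᵠ N))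
  𝔼-ones≡binomial (suc N) (suc k) =
    trans (𝔼₁-cong (𝔼-ones≡binomial N k) (𝔼-ones≡binomial N (suc k))) (sym (binomial-suc N k))

  binomial≤M : ∀ N k → binomial N k ≤ M q N
  binomial≤M N k = [ in-range , beyond ]′ (ℕP.≤-<-connex k N)
    where
    in-range : k ℕ.≤ N → binomial N k ≤ M q N
    in-range k≤N = max₀-upper (∈-map⁺ (binomial N) (∈-upTo⁺ (ℕ.s≤s k≤N)))
    beyond : N ℕ.< k → binomial N k ≤ M q N
    beyond N<k = subst (_≤ M q N) (sym (binomial-beyond N k N<k)) (max₀-nonNeg (L.map (binomial N) (L.upTo (suc N))))

  M-nonNeg : ∀ N → 0ℚ ≤ M q N
  M-nonNeg N = max₀-nonNeg (L.map (binomial N) (L.upTo (suc N)))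

  M-attained : ∀ N → M q N ≡ 0ℚ ⊎ Σ ℕ (λ k → M q N ≡ binomial N k)
  M-attained N = max₀-map-attained (binomial N) (L.upTo (suc N))

  𝟙ones≡ : ∀ {N D} → Vec ℕ D → Vec (Vec Bool N) D → ℚ
  𝟙ones≡ [] [] = 1ℚ
  𝟙ones≡ (v ∷ vs) (c ∷ cs) = 𝟙≡ (ones c) v * 𝟙ones≡ vs cs

  ∏binomial : ∀ {D} → ℕ → Vec ℕ D → ℚ
  ∏binomial N [] = 1ℚ
  ∏binomial N (v ∷ vs) = binomial N v * ∏binomial N vs

  ∏binomial-replicate : ∀ N k D → ∏binomial N (V.replicate D k) ≡ binomial N k ^ᵠ D
  ∏binomial-replicate N k zero = refl
  ∏binomial-replicate N k (suc D) = cong (binomial N k *_) (∏binomial-replicate N k D)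

  𝔼ᴹ-𝟙ones≡ : ∀ D N (vs : Vec ℕ D) → 𝔼ᴹ D N (𝟙ones≡ vs) ≡ ∏binomial N vs
  𝔼ᴹ-𝟙ones≡ zero N [] = refl
  𝔼ᴹ-𝟙ones≡ (suc D) N (v ∷ vs) =
    begin
      𝔼 N (λ c → 𝔼ᴹ D N (λ cs → 𝟙≡ (ones c) v * 𝟙ones≡ vs cs))
    ≡⟨ 𝔼-cong N (λ c → trans (𝔼ᴹ-scale D N (𝟙≡ (ones c) v) (𝟙ones≡ vs)) (trans (cong (𝟙≡ (ones c) v *_) (𝔼ᴹ-𝟙ones≡ D N vs)) (ℚP.*-comm (𝟙≡ (ones c) v) (∏binomial N vs)))) ⟩
      𝔼 N (λ c → ∏binomial N vs * 𝟙≡ (ones c) v)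
    ≡⟨ 𝔼-scale N (∏binomial N vs) (λ c → 𝟙≡ (ones c) v) ⟩
      ∏binomial N vs * 𝔼 N (λ c → 𝟙≡ (ones c) v)
    ≡⟨ trans (cong (∏binomial N vs *_) (𝔼-ones≡binomial N v)) (ℚP.*-comm (∏binomial N vs) (binomial N v)) ⟩
      binomial N v * ∏binomial N vs
    ∎
    where open ≡-Reasoning

  𝟙ones≡-cases : ∀ {N D} (vs : Vec ℕ D) (cs : Vec (Vec Bool N) D) → (V.map ones cs ≡ vs × 𝟙ones≡ vs cs ≡ 1ℚ) ⊎ 𝟙ones≡ vs cs ≡ 0ℚ
  𝟙ones≡-cases [] [] = inj₁ (refl , refl)
  𝟙ones≡-cases (v ∷ vs) (c ∷ cs) with ones c ℕ.≡ᵇ v in eq | 𝟙ones≡-cases vs cs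
  ... | true | inj₁ (ones≡ , ≡1) = inj₁ (cong₂ _∷_ (ℕP.≡ᵇ⇒≡ (ones c) v (subst T (sym eq) _)) ones≡ , trans (cong (1ℚ *_) ≡1) (ℚP.*-identityˡ 1ℚ))
  ... | true | inj₂ ≡0 = inj₂ (trans (cong (1ℚ *_) ≡0) (ℚP.*-zeroʳ 1ℚ))
  ... | false | _ = inj₂ (ℚP.*-zeroˡ (𝟙ones≡ vs cs))

  𝟙ones≡-nonNeg : ∀ {N D} (vs : Vec ℕ D) (cs : Vec (Vec Bool N) D) → 0ℚ ≤ 𝟙ones≡ vs cs
  𝟙ones≡-nonNeg vs cs with 𝟙ones≡-cases vs cs
  ... | inj₁ (_ , ≡1) = subst (0ℚ ≤_) (sym ≡1) 0≤1
  ... | inj₂ ≡0 = subst (0ℚ ≤_) (sym ≡0) ℚP.≤-refl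

  𝟙ones≡-one : ∀ {N D} (vs : Vec ℕ D) (cs : Vec (Vec Bool N) D) → V.map ones cs ≡ vs → 𝟙ones≡ vs cs ≡ 1ℚ
  𝟙ones≡-one [] [] _ = refl
  𝟙ones≡-one (v ∷ vs) (c ∷ cs) ones≡ with ones c ℕ.≡ᵇ v in eq
  ... | true = trans (cong (1ℚ *_) (𝟙ones≡-one vs cs (∷-injectiveʳ ones≡))) (ℚP.*-identityˡ 1ℚ)
  ... | false = ⊥-elim (subst T eq (ℕP.≡⇒≡ᵇ (ones c) v (∷-injectiveˡ ones≡)))

  𝟙-nonNeg : ∀ {X : Set} {A : X → Set} (A? : ∀ x → Dec (A x)) x → 0ℚ ≤ 𝟙 A? x
  𝟙-nonNeg A? x with A? x
  ... | yes _ = 0≤1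
  ... | no _ = ℚP.≤-refl

  search : ∀ n {P : Vec Bool n → Set} → (∀ x → Dec (P x)) → Dec (Σ (Vec Bool n) P)
  search zero P? with P? []
  ... | yes p = yes ([] , p)
  ... | no ¬p = no (λ { ([] , p) → ¬p p })
  search (suc n) {P} P? with search n (λ v → P? (true ∷ v)) | search n (λ v → P? (false ∷ v))
  ... | yes (v , p) | _ = yes (true ∷ v , p)
  ... | no _ | yes (v , p) = yes (false ∷ v , p)
  ... | no ¬true | no ¬false = no λ { (true ∷ v , p) → ¬true (v , p) ; (false ∷ v , p) → ¬false (v , p) }

  searchᴹ : ∀ D N {P : Vec (Vec Bool N) D → Set} → (∀ x → Dec (P x)) → Dec (Σ (Vec (Vec Bool N) D) P)
  searchᴹ zero N P? with P? []
  ... | yes p = yes ([] , p)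
  ... | no ¬p = no (λ { ([] , p) → ¬p p })
  searchᴹ (suc D) N {P} P? with search N (λ c → searchᴹ D N (λ cs → P? (c ∷ cs)))
  ... | yes (c , cs , p) = yes (c ∷ cs , p)
  ... | no ¬p = no (λ { (c ∷ cs , p) → ¬p (c , cs , p) })

  module ProbabilityBounds (0≤q : 0ℚ ≤ q) (0≤1-q : 0ℚ ≤ 1ℚ - q) where
    open Monotone 0≤q 0≤1-q

    binomial-nonNeg : ∀ N k → 0ℚ ≤ binomial N k
    binomial-nonNeg N k = subst (0ℚ ≤_) (𝔼-ones≡binomial N k) (𝔼-nonNeg N (λ c → 𝟙≡-nonNeg (ones c) k))

    ∏binomial-nonNeg : ∀ N {D} (vs : Vec ℕ D) → 0ℚ ≤ ∏binomial N vs
    ∏binomial-nonNeg N [] = 0≤1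
    ∏binomial-nonNeg N (v ∷ vs) = *-nonNeg (binomial-nonNeg N v) (∏binomial-nonNeg N vs)

    ∏binomial≤M^ : ∀ N {D} (vs : Vec ℕ D) → ∏binomial N vs ≤ M q N ^ᵠ D
    ∏binomial≤M^ N [] = ℚP.≤-refl
    ∏binomial≤M^ N (v ∷ vs) = *-mono-≤-nonNeg (binomial-nonNeg N v) (∏binomial-nonNeg N vs) (binomial≤M N v) (∏binomial≤M^ N vs)

    -- A point x₀ of A, if there is one, fixes the column counts: 𝟙 A? ≤ 𝟙ones≡ (map ones x₀).
    𝔼ᴹ-𝟙≤M^ : ∀ D N {A : Vec (Vec Bool N) D → Set} (A? : ∀ x → Dec (A x)) →
              (∀ x y → A x → A y → V.map ones x ≡ V.map ones y) → 𝔼ᴹ D N (𝟙 A?) ≤ M q N ^ᵠ D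
    𝔼ᴹ-𝟙≤M^ D N {A} A? same-ones = by-witness (searchᴹ D N A?)
      where
      by-witness : Dec (Σ (Vec (Vec Bool N) D) A) → 𝔼ᴹ D N (𝟙 A?) ≤ M q N ^ᵠ D
      by-witness (no ¬A) = subst (_≤ M q N ^ᵠ D) (sym (trans (𝔼ᴹ-cong D N 𝟙≡0) (𝔼ᴹ-const D N 0ℚ))) (^-nonNeg D (M-nonNeg N))
        where
        𝟙≡0 : ∀ x → 𝟙 A? x ≡ 0ℚ
        𝟙≡0 x with A? x
        ... | yes a = ⊥-elim (¬A (x , a))
        ... | no _ = refl
      by-witness (yes (x₀ , a₀)) =
        ℚP.≤-trans (𝔼ᴹ-mono D N 𝟙≤) (subst (_≤ M q N ^ᵠ D) (sym (𝔼ᴹ-𝟙ones≡ D N (V.map ones x₀))) (∏binomial≤M^ N (V.map ones x₀)))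
        where
        𝟙≤ : ∀ x → 𝟙 A? x ≤ 𝟙ones≡ (V.map ones x₀) x
        𝟙≤ x with A? x
        ... | yes a = ℚP.≤-reflexive (sym (𝟙ones≡-one (V.map ones x₀) x (same-ones x x₀ a a₀)))
        ... | no _ = 𝟙ones≡-nonNeg (V.map ones x₀) x

module Bounds (q : ℚ) (0≤q : 0ℚ ℚ.≤ q) (0≤1-q : 0ℚ ℚ.≤ 1ℚ ℚ.- q) where

  open import Defs
  open Polynomial
  open MonicDivision
  open Divisibility
  open Cyclotomic
  open ColumnSums
  open Expectation q
  open Monotone 0≤q 0≤1-q
  open Binomial q
  open ProbabilityBounds 0≤q 0≤1-q
  open import Data.Nat as ℕ using (ℕ; suc; _*_; _+_; _≤_; s≤s; z≤n)
  import Data.Nat.Properties as ℕP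
  open import Data.Nat.Primality using (Prime)
  import Data.Rational.Properties as ℚP
  open import Data.Integer using (+_)
  open import Data.Vec as V using (Vec; _++_; concat; transpose)
  open import Data.Bool using (Bool)
  open import Data.Product using (Σ; _,_; proj₂)
  open import Data.Sum using (inj₁; inj₂; [_,_]′)
  open import Data.Empty using (⊥-elim)
  open import Relation.Nullary using (Dec; yes; no)
  open import Relation.Binary.PropositionalEquality

  -- The n = N d coefficients of f, read row by row, form an N × d matrix; its d columns are independent.
  Pq≡𝔼ᴹ-columns : ∀ N d (dec : (c : Vec Bool (N * d)) → Dec (Φ d ∣ₚ polyOf c)) →
                  Pq q d (N * d) dec ≡ 𝔼ᴹ d N (𝟙 (λ cols → dec (concat (transpose cols))))
  Pq≡𝔼ᴹ-columns N d dec = trans (Prob≡𝔼 (N * d) dec) (trans (𝔼-concat N d (𝟙 dec)) (𝔼ᴹ-transpose N d (λ rows → 𝟙 dec (concat rows))))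

  -- Conditioning on the last m columns, the first D column sums are determined.
  𝔼ᴹ-𝟙≤M^-conditioned : ∀ d D m → D + m ≡ d → ∀ N {A : Vec (Vec Bool N) d → Set} (A? : ∀ x → Dec (A x)) →
    (∀ x y → A x → A y → (∀ i → D ≤ i → coeff (columnSums x) i ≡ coeff (columnSums y) i) → ∀ i → coeff (columnSums x) i ≡ coeff (columnSums y) i) →
    𝔼ᴹ d N (𝟙 A?) ℚ.≤ M q N ^ᵠ D
  𝔼ᴹ-𝟙≤M^-conditioned .(D + m) D m refl N {A} A? determined =
    subst (ℚ._≤ M q N ^ᵠ D) (sym (trans (𝔼ᴹ-++ D m N (𝟙 A?)) (𝔼ᴹ-swap D m N (λ low high → 𝟙 A? (low ++ high)))))
      (subst (𝔼ᴹ m N (λ high → 𝔼ᴹ D N (λ low → 𝟙 A? (low ++ high))) ℚ.≤_) (𝔼ᴹ-const m N (M q N ^ᵠ D))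
        (𝔼ᴹ-mono m N (λ high → 𝔼ᴹ-𝟙≤M^ D N (λ low → A? (low ++ high)) (same-ones high))))
    where
    same-ones : ∀ high x y → A (x ++ high) → A (y ++ high) → V.map ones x ≡ V.map ones y
    same-ones high x y ax ay =
      columnSums-++-injective x y high (determined (x ++ high) (y ++ high) ax ay (coeff-columnSums-++-≥ x y high))

  upper-bound : ∀ N d′ (dec : (c : Vec Bool (N * suc d′)) → Dec (Φ (suc d′) ∣ₚ polyOf c)) →
                Pq q (suc d′) (N * suc d′) dec ℚ.≤ M q N ^ᵠ totient (suc d′)
  upper-bound N d′ dec =
    subst (ℚ._≤ M q N ^ᵠ D) (sym (Pq≡𝔼ᴹ-columns N d dec))
      (𝔼ᴹ-𝟙≤M^-conditioned d D (d ℕ.∸ D) (ℕP.m+[n∸m]≡n D≤d) N A? determined)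
    where
    d = suc d′
    D = totient d
    monic = monic-Φ d (s≤s z≤n)
    D≤d : D ≤ d
    D≤d = monic-∣-monic⇒≤ monic (proj₂ (Φ∣xpm1 d′)) (monic-xpm1 d′)
    A? = λ (cols : Vec (Vec Bool N) d) → dec (concat (transpose cols))
    Φ∣columnSums : ∀ cols → Φ d ∣ₚ polyOf (concat (transpose cols)) → Φ d ∣≈ columnSums cols
    Φ∣columnSums cols Φ∣ =
      ∣-mod⇒∣ʳ {Φ d} {polyOf (concat (transpose cols))} {columnSums cols} {xpm1 d} {cofactor (transpose cols)}
        (Φ∣xpm1 d′) (polyOf-concat-transpose cols) (∣ₚ⇒∣≈ {Φ d} {polyOf (concat (transpose cols))} Φ∣)
    determined : ∀ x y → Φ d ∣ₚ polyOf (concat (transpose x)) → Φ d ∣ₚ polyOf (concat (transpose y)) →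
                 (∀ i → D ≤ i → coeff (columnSums x) i ≡ coeff (columnSums y) i) → ∀ i → coeff (columnSums x) i ≡ coeff (columnSums y) i
    determined x y Φ∣x Φ∣y = ∣-monic-coeffs≥⇒≡ monic (Φ∣columnSums x Φ∣x) (Φ∣columnSums y Φ∣y)

  lower-bound : ∀ N d′ (dec : (c : Vec Bool (N * suc d′)) → Dec (Φ (suc d′) ∣ₚ polyOf c)) → Prime (suc d′) →
                M q N ^ᵠ suc d′ ℚ.≤ Pq q (suc d′) (N * suc d′) dec
  lower-bound N d′ dec d-prime = subst (M q N ^ᵠ d ℚ.≤_) (sym (Pq≡𝔼ᴹ-columns N d dec)) M^d≤
    where
    d = suc d′
    A? = λ (cols : Vec (Vec Bool N) d) → dec (concat (transpose cols))
    equal-sums⇒Φ∣ : ∀ cols k → V.map ones cols ≡ V.replicate d k → Φ d ∣ₚ polyOf (concat (transpose cols))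
    equal-sums⇒Φ∣ cols k ones≡k =
      ∣≈⇒∣ₚ {Φ d} {polyOf (concat (transpose cols))}
        (∣-mod⇒∣ˡ {Φ d} {polyOf (concat (transpose cols))} {columnSums cols} {xpm1 d} {cofactor (transpose cols)}
          (Φ∣xpm1 d′) (polyOf-concat-transpose cols) (const (+ k) , Φ*k≈))
      where
      Φ*k≈ : mulP (Φ d) (const (+ k)) ≈ columnSums cols
      Φ*k≈ = ≈-trans (mul-congˡ (const (+ k)) (Φ-prime d d-prime))
              (≈-trans (mul-comm (geometric 1 d) (const (+ k)))
               (≈-trans (mul-congʳ (const (+ k)) (≈-sym (replicate≈geometric d)))
                (≈-trans (const*replicate d (+ k)) (≡⇒≈ (sym (columnSums-replicate cols k ones≡k))))))
    𝟙ones≡≤𝟙 : ∀ k cols → 𝟙ones≡ (V.replicate d k) cols ℚ.≤ 𝟙 A? cols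
    𝟙ones≡≤𝟙 k cols with 𝟙ones≡-cases (V.replicate d k) cols
    ... | inj₂ ≡0 = subst (ℚ._≤ 𝟙 A? cols) (sym ≡0) (𝟙-nonNeg A? cols)
    ... | inj₁ (ones≡k , ≡1) with A? cols
    ...   | yes _ = ℚP.≤-reflexive ≡1
    ...   | no Φ∤ = ⊥-elim (Φ∤ (equal-sums⇒Φ∣ cols k ones≡k))
    M^d≤ : M q N ^ᵠ d ℚ.≤ 𝔼ᴹ d N (𝟙 A?)
    M^d≤ = [ M≡0 , M≡binomial ]′ (M-attained N)
      where
      M≡0 : M q N ≡ 0ℚ → M q N ^ᵠ d ℚ.≤ 𝔼ᴹ d N (𝟙 A?)
      M≡0 eq = subst (ℚ._≤ 𝔼ᴹ d N (𝟙 A?)) (sym (trans (cong (ℚ._* (M q N ^ᵠ d′)) eq) (ℚP.*-zeroˡ (M q N ^ᵠ d′)))) (𝔼ᴹ-nonNeg d N (𝟙-nonNeg A?))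
      M≡binomial : Σ ℕ (λ k → M q N ≡ binomial N k) → M q N ^ᵠ d ℚ.≤ 𝔼ᴹ d N (𝟙 A?)
      M≡binomial (k , eq) =
        subst (ℚ._≤ 𝔼ᴹ d N (𝟙 A?)) (sym (trans (cong (_^ᵠ d) eq) (trans (sym (∏binomial-replicate N k d)) (sym (𝔼ᴹ-𝟙ones≡ d N (V.replicate d k))))))
          (𝔼ᴹ-mono d N (𝟙ones≡≤𝟙 k))

p≤q⇒0≤q-p : ∀ {p q} → p ℚ.≤ q → 0ℚ ℚ.≤ q ℚ.- p
p≤q⇒0≤q-p {p} {q} p≤q = subst (ℚ._≤ q ℚ.- p) (ℚP.+-inverseʳ p) (ℚP.+-monoˡ-≤ (ℚ.- p) p≤q)

proposition3p2 : (n : ℕ) → 0 < n → (d : ℕ) → 0 < d → d ≢ 1 → (d∣n : d ∣ n) →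
    (q : ℚ) → 0ℚ ℚ.< q → q ℚ.< 1ℚ →
    (dec : (c : Vec Bool n) → Dec (Φ d ∣ₚ polyOf c)) →
    (Pq q d n dec ℚ.≤ (M q (quotient d∣n) ^ᵠ totient d))
    × (Prime d → (M q (quotient d∣n) ^ᵠ d) ℚ.≤ Pq q d n dec)
proposition3p2 .(N ℕ.* ℕ.suc d′) _ (ℕ.suc d′) _ _ (divides N refl) q 0<q q<1 dec =
  upper-bound N d′ dec , lower-bound N d′ dec
  where open Bounds q (ℚP.<⇒≤ 0<q) (p≤q⇒0≤q-p (ℚP.<⇒≤ q<1))
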